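{- The decomposition $\mathcal{Y}Sym=\bigoplus_{k\geq0}(\mathcal{Y}Sym)^k$ is a coalgebra grading, and with this grading $\mathcal{Y}Sym$ is a cofree graded coalgebra; more precisely, the linear map $Q((\mathcal{Y}Sym)^1)\to\mathcal{Y}Sym$ sending $M_{t_1}\otimes\cdots\otimes M_{t_k}\mapsto M_{t_1\backslash\cdots\backslash t_k}$ ($t_i$ progressive) is an isomorphism of graded coalgebras.
   Context: $\mathcal{Y}_n$: rooted planar binary trees with $n$ internal nodes, $\mathcal{Y}_0=\{|\}$, each $t$ ($n\ge1$) uniquely $t_l\vee t_r$; Tamari order generated by replacing a subtree $(A\vee B)\vee C$ by $A\vee(B\vee C)$. $|\backslash t=t$, $s\backslash t=s_l\vee(s_r\backslash t)$. A tree $t\neq|$ is progressive if $t_r=|$; every $t\neq|$ has a unique decomposition $t=t_1\backslash\cdots\backslash t_k$ into progressive trees, and $k$ is its number of progressive components ($|$ has $0$). $\mathcal{Y}^k$ is the set of trees (of any size) with exactly $k$ progressive components. $\mathcal{Y}Sym$ is the graded Hopf algebra over $\mathbb{Q}$ with basis $\{F_t\}$; coproduct $\Delta(F_t)=\sum_{i=0}^nF_{\lambda(\mathrm{st}(\gamma(t)(1..i)))}\otimes F_{\lambda(\mathrm{st}(\gamma(t)(i+1..n)))}$, where $\lambda(\mathrm{id}_0)=|$, $\lambda(\sigma)=\lambda(\mathrm{st}(\sigma(1..j-1)))\vee\lambda(\mathrm{st}(\sigma(j+1..n)))$ with $j=\sigma^{ -1}(n)$, $\gamma(|)=\mathrm{id}_0$,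 $\gamma(t)=\gamma(t_l)\vee\gamma(t_r)$, the permutation $\sigma\vee\tau$ having values $\sigma(1)+q,\dots,\sigma(p)+q,p+q+1,\tau(1),\dots,\tau(q)$, and st is standardization. Monomial basis $M_t=\sum_{s\geq t}\mu_{\mathcal{Y}_n}(t,s)F_s$ (Möbius function of Tamari order). $(\mathcal{Y}Sym)^k$ is the span of $\{M_t:t\in\mathcal{Y}^k\}$. A coalgebra grading means $\Delta((\mathcal{Y}Sym)^k)\subseteq\bigoplus_{i+j=k}(\mathcal{Y}Sym)^i\otimes(\mathcal{Y}Sym)^j$ and the counit vanishes on $(\mathcal{Y}Sym)^k$ for $k\geq1$. For a vector space $V$, the cofree graded coalgebra $Q(V)=\bigoplus_{k\geq0}V^{\otimes k}$ has the deconcatenation coproduct $\Delta(v_1\otimes\cdots\otimes v_k)=\sum_{i=0}^k(v_1\otimes\cdots\otimes v_i)\otimes(v_{i+1}\otimes\cdots\otimes v_k)$. -}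

module Defs where

open import Data.Bool using (Bool; true; false; _∧_; _∨_; if_then_else_; T)
open import Data.Nat using (ℕ; zero; suc; _+_; _∸_; _<ᵇ_; _≡ᵇ_)
open import Data.Rational using (ℚ; 0ℚ; 1ℚ; -_) renaming (_+_ to _+ℚ_; _*_ to _*ℚ_)
open import Data.List using (List; []; _∷_; _++_; map; concatMap; length; upTo; take; drop; foldr)
open import Data.Bool.ListAction using (any)
open import Data.List.Relation.Unary.All using (All)
open import Data.Product using (Σ; _×_; _,_; proj₁; proj₂; ∃)
open import Relation.Binary.PropositionalEquality using (_≡_)

data Tree : Set where
  leaf : Tree
  node : Tree → Tree → Tree

size : Tree → ℕ
size leaf = 0
size (node l r) = suc (size l + size r)

_==T_ : Tree → Tree → Bool
leaf ==T leaf = true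
leaf ==T node _ _ = false
node _ _ ==T leaf = false
node a b ==T node c d = (a ==T c) ∧ (b ==T d)

-- all trees with n internal nodes (fuel f ≥ n)
treesF : ℕ → ℕ → List Tree
treesF _ zero = leaf ∷ []
treesF zero (suc n) = []
treesF (suc f) (suc n) =
  concatMap (λ i → concatMap (λ l → map (node l) (treesF f (n ∸ i))) (treesF f i)) (upTo (suc n))

trees : ℕ → List Tree
trees n = treesF n n

_＼_ : Tree → Tree → Tree
leaf ＼ t = t
node sl sr ＼ t = node sl (sr ＼ t)

data Progressive : Tree → Set where
  prog : (l : Tree) → Progressive (node l leaf)

over : List Tree → Tree
over = foldr _＼_ leaf

-- t ∈ 𝒴^k : t = t₁ \ ⋯ \ t_k with all tᵢ progressive
-- (the decomposition is unique, so this is "exactly k components")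
InY : ℕ → Tree → Set
InY k t = Σ (List Tree) λ ts → All Progressive ts × length ts ≡ k × over ts ≡ t

rotAtRoot : Tree → Tree → List Tree
rotAtRoot leaf c = []
rotAtRoot (node a b) c = node a (node b c) ∷ []

rots : Tree → List Tree
rots leaf = []
rots (node l r) = rotAtRoot l r ++ (map (λ l' → node l' r) (rots l) ++ map (node l) (rots r))

reachF : ℕ → Tree → Tree → Bool
reachF zero s t = s ==T t
reachF (suc f) s t = (s ==T t) ∨ any (λ u → reachF f u t) (rots s)

-- s ≤ t in the Tamari order (reflexive-transitive closure of rotation);
-- a shortest rotation path has no repeated tree, so |𝒴_n| steps suffice.
leqT : Tree → Tree → Bool
leqT s t = reachF (length (trees (size s))) s t

_≤T_ : Tree → Tree → Set
s ≤T t = T (leqT s t)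

sumℚ : List ℚ → ℚ
sumℚ = foldr _+ℚ_ 0ℚ

filterB : {A : Set} → (A → Bool) → List A → List A
filterB p [] = []
filterB p (x ∷ xs) = if p x then x ∷ filterB p xs else filterB p xs

mobF : ℕ → Tree → Tree → ℚ
mobF zero t s = 0ℚ
mobF (suc f) t s =
  if t ==T s then 1ℚ
  else if leqT t s
       then - sumℚ (map (mobF f t)
                (filterB (λ u → leqT t u ∧ leqT u s ∧ (if u ==T s then false else true))
                         (trees (size t))))
       else 0ℚ

mob : Tree → Tree → ℚ
mob t s = mobF (suc (length (trees (size t)))) t s

-- element of 𝒴Sym in the F-basis:  Σ c F_t
YElt : Set
YElt = List (ℚ × Tree)

-- element of 𝒴Sym ⊗ 𝒴Sym in the basis F_s ⊗ F_u
YYElt : Set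
YYElt = List (ℚ × Tree × Tree)

coeffF : YElt → Tree → ℚ
coeffF y t = sumℚ (map (λ p → if proj₂ p ==T t then proj₁ p else 0ℚ) y)

coeffFF : YYElt → Tree → Tree → ℚ
coeffFF z s u =
  sumℚ (map (λ p → if (proj₁ (proj₂ p) ==T s) ∧ (proj₂ (proj₂ p) ==T u) then proj₁ p else 0ℚ) z)

_≈Y_ : YElt → YElt → Set
x ≈Y y = ∀ t → coeffF x t ≡ coeffF y t

_≈YY_ : YYElt → YYElt → Set
x ≈YY y = ∀ s u → coeffFF x s u ≡ coeffFF y s u

scaleY : ℚ → YElt → YElt
scaleY c = map (λ p → (c *ℚ proj₁ p , proj₂ p))

scaleYY : ℚ → YYElt → YYElt
scaleYY c = map (λ p → (c *ℚ proj₁ p , proj₂ p))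

M : Tree → YElt
M t = map (λ s → (mob t s , s)) (filterB (leqT t) (trees (size t)))

M⊗M : Tree → Tree → YYElt
M⊗M a b = concatMap (λ p → map (λ q → (proj₁ p *ℚ proj₁ q , proj₂ p , proj₂ q)) (M b)) (M a)

-- Permutations (as lists of values 1..n), λ, γ, coproduct

countB : {A : Set} → (A → Bool) → List A → ℕ
countB p xs = length (filterB p xs)

st : List ℕ → List ℕ
st xs = map (λ x → suc (countB (λ y → y <ᵇ x) xs)) xs

splitAtVal : ℕ → List ℕ → List ℕ × List ℕ
splitAtVal v [] = [] , []
splitAtVal v (x ∷ xs) =
  if x ≡ᵇ v then ([] , xs)
  else (x ∷ proj₁ (splitAtVal v xs) , proj₂ (splitAtVal v xs))

-- λ with fuel (fuel = length suffices)
lamF : ℕ → List ℕ → Tree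
lamF zero σ = leaf
lamF (suc f) [] = leaf
lamF (suc f) (x ∷ xs) =
  node (lamF f (st (proj₁ (splitAtVal (length (x ∷ xs)) (x ∷ xs)))))
       (lamF f (st (proj₂ (splitAtVal (length (x ∷ xs)) (x ∷ xs)))))

lam : List ℕ → Tree
lam σ = lamF (length σ) σ

_∨P_ : List ℕ → List ℕ → List ℕ
σ ∨P τ = map (λ x → x + length τ) σ ++ (suc (length σ + length τ) ∷ τ)

gam : Tree → List ℕ
gam leaf = []
gam (node l r) = gam l ∨P gam r

ΔF : Tree → YYElt
ΔF t = map (λ i → (1ℚ , lam (st (take i (gam t))) , lam (st (drop i (gam t)))))
           (upTo (suc (size t)))

ΔY : YElt → YYElt
ΔY y = concatMap (λ p → scaleYY (proj₁ p) (ΔF (proj₂ p))) y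

εY : YElt → ℚ
εY y = coeffF y leaf

InGrade : ℕ → YElt → Set
InGrade k y = Σ (List (Σ (ℚ × Tree) λ p → InY k (proj₂ p))) λ cs →
  y ≈Y concatMap (λ q → scaleY (proj₁ (proj₁ q)) (M (proj₂ (proj₁ q)))) cs

InGrade2 : ℕ → YYElt → Set
InGrade2 k z =
  Σ (List (Σ (ℚ × Tree × Tree) λ p →
      Σ ℕ λ i → Σ ℕ λ j → i + j ≡ k × InY i (proj₁ (proj₂ p)) × InY j (proj₂ (proj₂ p)))) λ cs →
  z ≈YY concatMap (λ q → scaleYY (proj₁ (proj₁ q)) (M⊗M (proj₁ (proj₂ (proj₁ q))) (proj₂ (proj₂ (proj₁ q))))) cs

-- Cofree coalgebra Q(V), V = (𝒴Sym)^1, in the basis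
-- M_{t₁} ⊗ ⋯ ⊗ M_{t_k} (tᵢ progressive), indexed by the list [t₁,…,t_k]

QElt : Set
QElt = List (ℚ × List Tree)

ValidQ : QElt → Set
ValidQ x = All (λ p → All Progressive (proj₂ p)) x

QQElt : Set
QQElt = List (ℚ × List Tree × List Tree)

eqListTree : List Tree → List Tree → Bool
eqListTree [] [] = true
eqListTree [] (_ ∷ _) = false
eqListTree (_ ∷ _) [] = false
eqListTree (a ∷ as) (b ∷ bs) = (a ==T b) ∧ eqListTree as bs

coeffQ : QElt → List Tree → ℚ
coeffQ x ts = sumℚ (map (λ p → if eqListTree (proj₂ p) ts then proj₁ p else 0ℚ) x)

_≈Q_ : QElt → QElt → Set
x ≈Q y = ∀ ts → coeffQ x ts ≡ coeffQ y ts

ΔQ : QElt → QQElt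
ΔQ x = concatMap (λ p → map (λ i → (proj₁ p , take i (proj₂ p) , drop i (proj₂ p)))
                            (upTo (suc (length (proj₂ p))))) x

εQ : QElt → ℚ
εQ x = coeffQ x []

φ : QElt → YElt
φ x = concatMap (λ p → scaleY (proj₁ p) (M (over (proj₂ p)))) x

φ⊗φ : QQElt → YYElt
φ⊗φ z = concatMap (λ p → scaleYY (proj₁ p) (M⊗M (over (proj₁ (proj₂ p))) (over (proj₂ (proj₂ p))))) z

basisQ : List Tree → QElt
basisQ ts = (1ℚ , ts) ∷ []

module Submission where

-- Write coeffM t s = [t ≤ s] μ(t,s) for the coefficient of F_s in M_t; the M-basis is unitriangular
-- over the F-basis for the Tamari order.  The coproduct of F_w is Σᵢ F_{w↾i} ⊗ F_{w↿i}, where w↾i and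
-- w↿i are the trees cut out of w by its first i nodes, and cutting is a Galois connection:
-- w ≤ s \ u iff w↾|s| ≤ s and w↿|s| ≤ u.  Hence summing the F ⊗ F-coefficients of ΔM_t over the lower
-- set of a pair (z₁, z₂) gives [t = z₁ \ z₂].  For t = t₁ \ ⋯ \ t_k with progressive tᵢ, the
-- deconcatenation Σᵢ M_{t₁\⋯\tᵢ} ⊗ M_{tᵢ₊₁\⋯\t_k} gives the same sums, because a tree factors uniquely
-- into progressive components.  Summation over lower sets is unitriangular, so ΔM_t is this
-- deconcatenation: φ is a morphism of graded coalgebras.  It is bijective because it maps the basis of
-- Q((𝒴Sym)¹) onto the M-basis.

open import Defs
open import Data.Bool using (Bool; true; false; _∧_; if_then_else_; T; not)
open import Data.Nat using (ℕ; zero; suc; _+_; _∸_; _*_; _≤_; _<_; _<ᵇ_; _≡ᵇ_; _≤ᵇ_; z≤n; s≤s)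
open import Data.Nat.ListAction using (sum)
open import Data.Nat.Tactic.RingSolver using (solve-∀)
open import Data.Rational using (ℚ; 0ℚ; 1ℚ; -_) renaming (_+_ to _+ℚ_; _*_ to _*ℚ_)
open import Data.List using (List; []; _∷_; _++_; map; concatMap; length; upTo; take; drop; applyUpTo)
open import Data.List.Relation.Unary.All using (All; []; _∷_; tabulate; all?; universal) renaming (map to Amap; lookup to Alookup)
open import Data.List.Relation.Unary.Any using (here; there)
open import Data.List.Relation.Unary.Any.Properties using (any⁺; any⁻)
open import Data.List.Membership.Propositional using (_∈_; find; lose)
open import Data.List.Membership.Propositional.Properties using (∈-map⁺; ∈-map⁻; ∈-++⁺ˡ; ∈-++⁺ʳ; ∈-++⁻)
open import Data.Product using (Σ; _×_; _,_; proj₁; proj₂; uncurry)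
open import Data.Sum using (inj₁; inj₂)
open import Data.Empty using (⊥-elim)
open import Function using (_∘_; id)
open import Function.Bundles using (Equivalence; _⇔_; mk⇔)
open import Relation.Binary.PropositionalEquality using (_≡_; refl; sym; trans; cong; cong₂; subst; subst₂; _≢_; module ≡-Reasoning)
open import Relation.Binary.Construct.Closure.ReflexiveTransitive using (Star; ε; _◅_; _◅◅_; gmap; kleisliStar; fold)
open import Relation.Nullary using (¬_; yes; no; Dec)
open import Relation.Nullary.Reflects using (Reflects; ofʸ; ofⁿ; det; _×-reflects_; ¬-reflects; fromEquivalence)
open import Algebra.Bundles using (CommutativeMonoid)
import Algebra.Properties.CommutativeSemigroup as CommSemigroupProperties
import Algebra.Properties.Group as GroupProperties
import Data.Bool.Properties as Bool
import Data.List.Properties as List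
import Data.List.Relation.Unary.All.Properties as All
import Data.Nat.Properties as ℕ
import Data.Rational.Properties as ℚ

module +-Props = CommSemigroupProperties (CommutativeMonoid.commutativeSemigroup ℚ.+-0-commutativeMonoid)
module *-Props = CommSemigroupProperties (CommutativeMonoid.commutativeSemigroup ℚ.*-1-commutativeMonoid)
module +-Group = GroupProperties ℚ.+-0-group

∑ : {A : Set} → List A → (A → ℚ) → ℚ
∑ xs f = sumℚ (map f xs)

∑-++ : {A : Set} (xs ys : List A) (f : A → ℚ) → ∑ (xs ++ ys) f ≡ ∑ xs f +ℚ ∑ ys f
∑-++ [] ys f = sym (ℚ.+-identityˡ _)
∑-++ (x ∷ xs) ys f = trans (cong (f x +ℚ_) (∑-++ xs ys f)) (sym (ℚ.+-assoc (f x) _ _))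

∑-concatMap : {A B : Set} (g : A → List B) (xs : List A) (f : B → ℚ) →
  ∑ (concatMap g xs) f ≡ ∑ xs (λ x → ∑ (g x) f)
∑-concatMap g [] f = refl
∑-concatMap g (x ∷ xs) f = trans (∑-++ (g x) (concatMap g xs) f) (cong (∑ (g x) f +ℚ_) (∑-concatMap g xs f))

∑-map : {A B : Set} (g : A → B) (xs : List A) (f : B → ℚ) → ∑ (map g xs) f ≡ ∑ xs (f ∘ g)
∑-map g [] f = refl
∑-map g (x ∷ xs) f = cong (f (g x) +ℚ_) (∑-map g xs f)

∑-cong-local : {A : Set} {P : A → Set} (xs : List A) → All P xs → {f g : A → ℚ} →
  (∀ x → P x → f x ≡ g x) → ∑ xs f ≡ ∑ xs g
∑-cong-local [] _ e = refl
∑-cong-local (x ∷ xs) (px ∷ pxs) e = cong₂ _+ℚ_ (e x px) (∑-cong-local xs pxs e)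

∑-cong : {A : Set} (xs : List A) {f g : A → ℚ} → (∀ x → f x ≡ g x) → ∑ xs f ≡ ∑ xs g
∑-cong [] e = refl
∑-cong (x ∷ xs) e = cong₂ _+ℚ_ (e x) (∑-cong xs e)

∑-0 : {A : Set} (xs : List A) → ∑ xs (λ _ → 0ℚ) ≡ 0ℚ
∑-0 [] = refl
∑-0 (x ∷ xs) = trans (ℚ.+-identityˡ _) (∑-0 xs)

∑-zero-local : {A : Set} {P : A → Set} (xs : List A) → All P xs → {f : A → ℚ} →
  (∀ x → P x → f x ≡ 0ℚ) → ∑ xs f ≡ 0ℚ
∑-zero-local xs ap e = trans (∑-cong-local xs ap {g = λ _ → 0ℚ} e) (∑-0 xs)

∑-zero : {A : Set} (xs : List A) {f : A → ℚ} → (∀ x → f x ≡ 0ℚ) → ∑ xs f ≡ 0ℚ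
∑-zero xs e = trans (∑-cong xs e) (∑-0 xs)

∑-distrib-+ : {A : Set} (xs : List A) (f g : A → ℚ) → ∑ xs (λ x → f x +ℚ g x) ≡ ∑ xs f +ℚ ∑ xs g
∑-distrib-+ [] f g = refl
∑-distrib-+ (x ∷ xs) f g = trans (cong (f x +ℚ g x +ℚ_) (∑-distrib-+ xs f g)) (+-Props.interchange (f x) (g x) _ _)

∑-*ˡ : {A : Set} (xs : List A) (c : ℚ) (f : A → ℚ) → ∑ xs (λ x → c *ℚ f x) ≡ c *ℚ ∑ xs f
∑-*ˡ [] c f = sym (ℚ.*-zeroʳ c)
∑-*ˡ (x ∷ xs) c f = trans (cong (c *ℚ f x +ℚ_) (∑-*ˡ xs c f)) (sym (ℚ.*-distribˡ-+ c (f x) _))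

∑-*ʳ : {A : Set} (xs : List A) (c : ℚ) (f : A → ℚ) → ∑ xs (λ x → f x *ℚ c) ≡ ∑ xs f *ℚ c
∑-*ʳ xs c f = trans (∑-cong xs (λ x → ℚ.*-comm (f x) c)) (trans (∑-*ˡ xs c f) (ℚ.*-comm c _))

∑-comm : {A B : Set} (xs : List A) (ys : List B) (f : A → B → ℚ) →
  ∑ xs (λ x → ∑ ys (f x)) ≡ ∑ ys (λ y → ∑ xs (λ x → f x y))
∑-comm [] ys f = sym (∑-0 ys)
∑-comm (x ∷ xs) ys f = trans (cong (∑ ys (f x) +ℚ_) (∑-comm xs ys f)) (sym (∑-distrib-+ ys (f x) _))

when : Bool → ℚ → ℚ
when b q = if b then q else 0ℚ

𝟙 : Bool → ℚ
𝟙 b = when b 1ℚ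

∑-filterB : {A : Set} (p : A → Bool) (xs : List A) (f : A → ℚ) → ∑ (filterB p xs) f ≡ ∑ xs (λ x → when (p x) (f x))
∑-filterB p [] f = refl
∑-filterB p (x ∷ xs) f with p x
... | true = cong (f x +ℚ_) (∑-filterB p xs f)
... | false = trans (∑-filterB p xs f) (sym (ℚ.+-identityˡ _))

∑-when : {A : Set} (b : Bool) (xs : List A) (f : A → ℚ) → ∑ xs (λ x → when b (f x)) ≡ when b (∑ xs f)
∑-when true xs f = refl
∑-when false xs f = ∑-0 xs

when-* : (b : Bool) (q c : ℚ) → when b q *ℚ c ≡ when b (q *ℚ c)
when-* true q c = refl
when-* false q c = ℚ.*-zeroˡ c

when-∧ : (a b : Bool) (q : ℚ) → when (a ∧ b) q ≡ when a (when b q)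
when-∧ true b q = refl
when-∧ false b q = refl

when-0 : (b : Bool) → when b 0ℚ ≡ 0ℚ
when-0 true = refl
when-0 false = refl

*-𝟙 : (b : Bool) (c : ℚ) → c *ℚ 𝟙 b ≡ when b c
*-𝟙 true c = ℚ.*-identityʳ c
*-𝟙 false c = ℚ.*-zeroʳ c

𝟙-* : (b : Bool) (c : ℚ) → 𝟙 b *ℚ c ≡ when b c
𝟙-* true c = ℚ.*-identityˡ c
𝟙-* false c = ℚ.*-zeroˡ c

𝟙-∧ : (a b : Bool) → 𝟙 (a ∧ b) ≡ 𝟙 a *ℚ 𝟙 b
𝟙-∧ a b = trans (when-∧ a b 1ℚ) (sym (𝟙-* a (𝟙 b)))

𝟙-∧-* : (a b : Bool) (c : ℚ) → 𝟙 (a ∧ b) *ℚ c ≡ when a (𝟙 b *ℚ c)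
𝟙-∧-* true b c = refl
𝟙-∧-* false b c = ℚ.*-zeroˡ c

∑< : ℕ → (ℕ → ℚ) → ℚ
∑< m g = sumℚ (applyUpTo g m)

∑-upTo : (m : ℕ) (g : ℕ → ℚ) → ∑ (upTo m) g ≡ ∑< m g
∑-upTo m g = cong sumℚ (List.map-upTo g m)

∑<-cong : (m : ℕ) {f g : ℕ → ℚ} → (∀ i → i < m → f i ≡ g i) → ∑< m f ≡ ∑< m g
∑<-cong zero e = refl
∑<-cong (suc m) e = cong₂ _+ℚ_ (e 0 (s≤s z≤n)) (∑<-cong m (λ i i<m → e (suc i) (s≤s i<m)))

∑<-zero : (m : ℕ) {g : ℕ → ℚ} → (∀ i → i < m → g i ≡ 0ℚ) → ∑< m g ≡ 0ℚ
∑<-zero zero e = refl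
∑<-zero (suc m) e = trans (cong₂ _+ℚ_ (e 0 (s≤s z≤n)) (∑<-zero m (λ i i<m → e (suc i) (s≤s i<m)))) (ℚ.+-identityˡ _)

∑<-when : (b : Bool) (m : ℕ) (g : ℕ → ℚ) → ∑< m (λ i → when b (g i)) ≡ when b (∑< m g)
∑<-when true m g = refl
∑<-when false m g = ∑<-zero m (λ i _ → refl)

∑<-single : (m j : ℕ) → j < m → (g : ℕ → ℚ) → (∀ i → i < m → i ≢ j → g i ≡ 0ℚ) → ∑< m g ≡ g j
∑<-single (suc m) zero j<m g e =
  trans (cong (g 0 +ℚ_) (∑<-zero m (λ i i<m → e (suc i) (s≤s i<m) (λ ())))) (ℚ.+-identityʳ _)
∑<-single (suc m) (suc j) (s≤s j<m) g e =
  trans (cong₂ _+ℚ_ (e 0 (s≤s z≤n) (λ ()))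
                    (∑<-single m j j<m (g ∘ suc) (λ i i<m i≢j → e (suc i) (s≤s i<m) (i≢j ∘ ℕ.suc-injective))))
        (ℚ.+-identityˡ _)

∑-∑-bilinear : {A B C : Set} (xs : List A) (ys : List B) (is : List C) (P : C → A → ℚ) (Q : C → B → ℚ) (f : A → ℚ) (g : B → ℚ) →
  ∑ xs (λ a → ∑ ys (λ b → ∑ is (λ i → P i a *ℚ Q i b) *ℚ (f a *ℚ g b)))
  ≡ ∑ is (λ i → ∑ xs (λ a → P i a *ℚ f a) *ℚ ∑ ys (λ b → Q i b *ℚ g b))
∑-∑-bilinear xs ys is P Q f g = begin
  ∑ xs (λ a → ∑ ys (λ b → ∑ is (λ i → P i a *ℚ Q i b) *ℚ (f a *ℚ g b)))
    ≡⟨ ∑-cong xs (λ a → ∑-cong ys (λ b → trans (sym (∑-*ʳ is (f a *ℚ g b) (λ i → P i a *ℚ Q i b)))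
                                               (∑-cong is (λ i → *-Props.interchange (P i a) (Q i b) (f a) (g b))))) ⟩
  ∑ xs (λ a → ∑ ys (λ b → ∑ is (λ i → (P i a *ℚ f a) *ℚ (Q i b *ℚ g b))))
    ≡⟨ ∑-cong xs (λ a → ∑-comm ys is (λ b i → (P i a *ℚ f a) *ℚ (Q i b *ℚ g b))) ⟩
  ∑ xs (λ a → ∑ is (λ i → ∑ ys (λ b → (P i a *ℚ f a) *ℚ (Q i b *ℚ g b))))
    ≡⟨ ∑-comm xs is (λ a i → ∑ ys (λ b → (P i a *ℚ f a) *ℚ (Q i b *ℚ g b))) ⟩
  ∑ is (λ i → ∑ xs (λ a → ∑ ys (λ b → (P i a *ℚ f a) *ℚ (Q i b *ℚ g b))))
    ≡⟨ ∑-cong is (λ i → trans (∑-cong xs (λ a → ∑-*ˡ ys (P i a *ℚ f a) (λ b → Q i b *ℚ g b)))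
                              (∑-*ʳ xs (∑ ys (λ b → Q i b *ℚ g b)) (λ a → P i a *ℚ f a))) ⟩
  ∑ is (λ i → ∑ xs (λ a → P i a *ℚ f a) *ℚ ∑ ys (λ b → Q i b *ℚ g b)) ∎
  where open ≡-Reasoning

module _ {A : Set} {b : Bool} (r : Reflects A b) where

  reflects-true : A → b ≡ true
  reflects-true a = det r (ofʸ a)

  reflects-false : ¬ A → b ≡ false
  reflects-false ¬a = det r (ofⁿ ¬a)

reflects-sound : {A : Set} {b : Bool} → Reflects A b → b ≡ true → A
reflects-sound (ofʸ a) _ = a

reflects-refute : {A : Set} {b : Bool} → Reflects A b → b ≡ false → ¬ A
reflects-refute (ofⁿ ¬a) _ = ¬a

reflects-map : {A B : Set} {b : Bool} → (A → B) → (B → A) → Reflects A b → Reflects B b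
reflects-map f g (ofʸ a) = ofʸ (f a)
reflects-map f g (ofⁿ ¬a) = ofⁿ (¬a ∘ g)

node-injective : ∀ {a b c d} → node a b ≡ node c d → a ≡ c × b ≡ d
node-injective refl = refl , refl

==T-reflects : ∀ s t → Reflects (s ≡ t) (s ==T t)
==T-reflects leaf leaf = ofʸ refl
==T-reflects leaf (node _ _) = ofⁿ λ ()
==T-reflects (node _ _) leaf = ofⁿ λ ()
==T-reflects (node a b) (node c d) =
  reflects-map (uncurry (cong₂ node)) node-injective (==T-reflects a c ×-reflects ==T-reflects b d)

==T-refl : ∀ t → (t ==T t) ≡ true
==T-refl t = reflects-true (==T-reflects t t) refl

==T-sym : ∀ s t → (s ==T t) ≡ (t ==T s)
==T-sym s t = det (==T-reflects s t) (reflects-map sym sym (==T-reflects t s))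

All-concatMap⁺ : {A B : Set} {P : B → Set} (g : A → List B) {xs : List A} →
  All (All P ∘ g) xs → All P (concatMap g xs)
All-concatMap⁺ g = All.concat⁺ ∘ All.map⁺

treesF-sized : ∀ f n → All (λ u → size u ≡ n) (treesF f n)
treesF-sized f zero = refl ∷ []
treesF-sized zero (suc n) = []
treesF-sized (suc f) (suc n) =
  All-concatMap⁺ (λ i → concatMap (λ l → map (node l) (treesF f (n ∸ i))) (treesF f i))
    (All.applyUpTo⁺₁ id (suc n) λ {i} i≤n → All-concatMap⁺ (λ l → map (node l) (treesF f (n ∸ i))) (Amap (λ {l} sl →
    All.map⁺ (Amap (λ {r} sr → cong suc (trans (cong₂ _+_ sl sr) (ℕ.m+[n∸m]≡n (ℕ.≤-pred i≤n))))
      (treesF-sized f (n ∸ i)))) (treesF-sized f i)))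

trees-sized : ∀ n → All (λ u → size u ≡ n) (trees n)
trees-sized n = treesF-sized n n

∑-pick-node : (L R : List Tree) (a b : Tree) (g : Tree → ℚ) →
  ∑ (concatMap (λ l → map (node l) R) L) (λ u → when (u ==T node a b) (g u))
  ≡ ∑ L (λ l → when (l ==T a) (∑ R (λ r → when (r ==T b) (g (node l r)))))
∑-pick-node L R a b g = trans (∑-concatMap _ L _) (∑-cong L λ l →
  trans (∑-map (node l) R _)
        (trans (∑-cong R (λ r → when-∧ (l ==T a) (r ==T b) (g (node l r)))) (∑-when (l ==T a) R _)))

∑-treesF-pick-none : ∀ f n s → size s ≢ n → (g : Tree → ℚ) →
  ∑ (treesF f n) (λ u → when (u ==T s) (g u)) ≡ 0ℚ
∑-treesF-pick-none f n s ns≢n g = ∑-zero-local (treesF f n) (treesF-sized f n) λ u su →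
  cong (λ b → when b (g u)) (reflects-false (==T-reflects u s) λ u≡s → ns≢n (trans (cong size (sym u≡s)) su))

∑-treesF-pick : ∀ f n s → n ≤ f → size s ≡ n → (g : Tree → ℚ) →
  ∑ (treesF f n) (λ u → when (u ==T s) (g u)) ≡ g s
∑-treesF-pick f zero leaf n≤f refl g = ℚ.+-identityʳ _
∑-treesF-pick (suc f) (suc m) (node a b) (s≤s m≤f) refl g = begin
  ∑ (concatMap H (upTo (suc m))) F       ≡⟨ trans (∑-concatMap H (upTo (suc m)) F) (∑-upTo (suc m) (λ i → ∑ (H i) F)) ⟩
  ∑< (suc m) (λ i → ∑ (H i) F)           ≡⟨ ∑<-single (suc m) (size a) (s≤s a≤m) (λ i → ∑ (H i) F) other ⟩
  ∑ (H (size a)) F                       ≡⟨ ∑-pick-node (treesF f (size a)) (treesF f (m ∸ size a)) a b g ⟩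
  ∑ (treesF f (size a)) (λ l → when (l ==T a) (∑ (treesF f (m ∸ size a)) (λ r → when (r ==T b) (g (node l r)))))
      ≡⟨ ∑-treesF-pick f (size a) a (ℕ.≤-trans a≤m m≤f) refl _ ⟩
  ∑ (treesF f (m ∸ size a)) (λ r → when (r ==T b) (g (node a r)))
      ≡⟨ ∑-treesF-pick f (m ∸ size a) b (ℕ.≤-trans (ℕ.m∸n≤m m (size a)) m≤f) (sym (ℕ.m+n∸m≡n (size a) (size b))) _ ⟩
  g (node a b) ∎
  where
  open ≡-Reasoning
  a≤m : size a ≤ m
  a≤m = ℕ.m≤m+n (size a) (size b)
  F : Tree → ℚ
  F u = when (u ==T node a b) (g u)
  H : ℕ → List Tree
  H i = concatMap (λ l → map (node l) (treesF f (m ∸ i))) (treesF f i)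
  other : ∀ i → i < suc m → i ≢ size a → ∑ (H i) F ≡ 0ℚ
  other i _ i≢a = trans (∑-pick-node (treesF f i) (treesF f (m ∸ i)) a b g)
                        (∑-treesF-pick-none f i a (i≢a ∘ sym) _)

∑-trees-pick : ∀ n s → size s ≡ n → (g : Tree → ℚ) → ∑ (trees n) (λ u → when (u ==T s) (g u)) ≡ g s
∑-trees-pick n s = ∑-treesF-pick n n s ℕ.≤-refl

∑-trees-pick-none : ∀ n s → size s ≢ n → (g : Tree → ℚ) → ∑ (trees n) (λ u → when (u ==T s) (g u)) ≡ 0ℚ
∑-trees-pick-none n = ∑-treesF-pick-none n n

∑-trees-pick-vanishing : ∀ n s (g : Tree → ℚ) → (size s ≢ n → g s ≡ 0ℚ) → ∑ (trees n) (λ u → when (u ==T s) (g u)) ≡ g s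
∑-trees-pick-vanishing n s g vanish with size s ℕ.≟ n
... | yes ≡n = ∑-trees-pick n s ≡n g
... | no ≢n = trans (∑-trees-pick-none n s ≢n g) (sym (vanish ≢n))

-- The Tamari order

data Rotation : Tree → Tree → Set where
  rotate  : ∀ a b c → Rotation (node (node a b) c) (node a (node b c))
  rotateˡ : ∀ {l l'} r → Rotation l l' → Rotation (node l r) (node l' r)
  rotateʳ : ∀ l {r r'} → Rotation r r' → Rotation (node l r) (node l r')

infix 4 _⊑_

_⊑_ : Tree → Tree → Set
_⊑_ = Star Rotation

⊑-nodeˡ : ∀ {l l'} r → l ⊑ l' → node l r ⊑ node l' r
⊑-nodeˡ r = gmap (λ x → node x r) (rotateˡ r)

⊑-nodeʳ : ∀ l {r r'} → r ⊑ r' → node l r ⊑ node l r'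
⊑-nodeʳ l = gmap (node l) (rotateʳ l)

Rotation-size : ∀ {s t} → Rotation s t → size s ≡ size t
Rotation-size (rotate a b c) = cong suc (assoc (size a) (size b) (size c))
  where
  assoc : ∀ x y z → suc (x + y) + z ≡ x + suc (y + z)
  assoc = solve-∀
Rotation-size (rotateˡ r ρ) = cong (λ k → suc (k + size r)) (Rotation-size ρ)
Rotation-size (rotateʳ l ρ) = cong (λ k → suc (size l + k)) (Rotation-size ρ)

⊑-size : ∀ {s t} → s ⊑ t → size s ≡ size t
⊑-size = fold (λ s t → size s ≡ size t) (trans ∘ Rotation-size) refl

-- Strictly increases along rotations and stays below |𝒴ₙ|, which bounds the fuel needed by
-- leqT and mob and drives every recursion along the Tamari order.
potential : Tree → ℕ
potential leaf = 0
potential (node l r) = potential l + potential r + size r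

Rotation-potential : ∀ {s t} → Rotation s t → potential s < potential t
Rotation-potential (rotate a b c) =
  subst (potential a + potential b + size b + potential c + size c <_)
        (shuffle (potential a) (potential b) (potential c) (size b) (size c))
        (s≤s (ℕ.m≤m+n _ (size c)))
  where
  shuffle : ∀ pa pb pc sb sc → suc (pa + pb + sb + pc + sc + sc) ≡ pa + (pb + pc + sc) + suc (sb + sc)
  shuffle = solve-∀
Rotation-potential (rotateˡ r ρ) = ℕ.+-monoˡ-< (size r) (ℕ.+-monoˡ-< _ (Rotation-potential ρ))
Rotation-potential (rotateʳ l {r} {r'} ρ) =
  subst (λ k → potential l + potential r + size r < potential l + potential r' + k) (Rotation-size ρ)
        (ℕ.+-monoˡ-< (size r) (ℕ.+-monoʳ-< (potential l) (Rotation-potential ρ)))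

⊑-potential : ∀ {s t} → s ⊑ t → potential s ≤ potential t
⊑-potential = fold (λ s t → potential s ≤ potential t) (ℕ.≤-trans ∘ ℕ.<⇒≤ ∘ Rotation-potential) ℕ.≤-refl

⊑-potential-< : ∀ {s t} → s ⊑ t → s ≢ t → potential s < potential t
⊑-potential-< ε s≢s = ⊥-elim (s≢s refl)
⊑-potential-< (ρ ◅ p) _ = ℕ.<-≤-trans (Rotation-potential ρ) (⊑-potential p)

⊑-antisym : ∀ {s t} → s ⊑ t → t ⊑ s → s ≡ t
⊑-antisym {s} {t} p q with s ==T t | ==T-reflects s t
... | true  | ofʸ s≡t = s≡t
... | false | ofⁿ s≢t = ⊥-elim (ℕ.<-irrefl refl (ℕ.<-≤-trans (⊑-potential-< p s≢t) (⊑-potential q)))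

Rotation⇒∈-rots : ∀ {s u} → Rotation s u → u ∈ rots s
Rotation⇒∈-rots (rotate a b c) = here refl
Rotation⇒∈-rots (rotateˡ {l} r ρ) =
  ∈-++⁺ʳ (rotAtRoot l r) (∈-++⁺ˡ (∈-map⁺ (λ l' → node l' r) (Rotation⇒∈-rots ρ)))
Rotation⇒∈-rots (rotateʳ l {r} ρ) =
  ∈-++⁺ʳ (rotAtRoot l r) (∈-++⁺ʳ (map (λ l' → node l' r) (rots l)) (∈-map⁺ (node l) (Rotation⇒∈-rots ρ)))

∈-rots⇒Rotation : ∀ {s u} → u ∈ rots s → Rotation s u
∈-rots⇒Rotation {node l r} u∈ with ∈-++⁻ (rotAtRoot l r) u∈
∈-rots⇒Rotation {node (node a b) r} _ | inj₁ (here refl) = rotate a b r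
... | inj₂ u∈′ with ∈-++⁻ (map (λ l' → node l' r) (rots l)) u∈′
...   | inj₁ u∈ˡ with ∈-map⁻ (λ l' → node l' r) u∈ˡ
...     | _ , l'∈ , refl = rotateˡ r (∈-rots⇒Rotation l'∈)
∈-rots⇒Rotation {node l r} _ | inj₂ _ | inj₂ u∈ʳ with ∈-map⁻ (node l) u∈ʳ
...     | _ , r'∈ , refl = rotateʳ l (∈-rots⇒Rotation r'∈)

T-==T-sound : ∀ s t → T (s ==T t) → s ≡ t
T-==T-sound s t = reflects-sound (==T-reflects s t) ∘ Equivalence.to Bool.T-≡

T-==T-refl : ∀ t → T (t ==T t)
T-==T-refl t = Equivalence.from Bool.T-≡ (==T-refl t)

reachF-sound : ∀ f s t → T (reachF f s t) → s ⊑ t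
reachF-sound zero s t h with T-==T-sound s t h
... | refl = ε
reachF-sound (suc f) s t h with Equivalence.to (Bool.T-∨ {s ==T t}) h
... | inj₁ s=t with T-==T-sound s t s=t
...   | refl = ε
reachF-sound (suc f) s t h | inj₂ viaRotation with find (any⁻ (λ u → reachF f u t) (rots s) viaRotation)
...   | u , u∈ , reach = ∈-rots⇒Rotation u∈ ◅ reachF-sound f u t reach

reachF-complete : ∀ f {s t} → s ⊑ t → potential t ∸ potential s ≤ f → T (reachF f s t)
reachF-complete zero {s} ε _ = T-==T-refl s
reachF-complete (suc f) {s} ε _ = Equivalence.from Bool.T-∨ (inj₁ (T-==T-refl s))
reachF-complete zero (ρ ◅ p) gap≤0 =
  ⊥-elim (ℕ.<-irrefl refl (ℕ.<-≤-trans (ℕ.m<n⇒0<n∸m (ℕ.<-≤-trans (Rotation-potential ρ) (⊑-potential p))) gap≤0))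
reachF-complete (suc f) {s} {t} (ρ ◅ p) gap≤ = Equivalence.from (Bool.T-∨ {s ==T t}) (inj₂ (any⁺ (λ u → reachF f u t)
  (lose (Rotation⇒∈-rots ρ) (reachF-complete f p
    (ℕ.≤-pred (ℕ.≤-trans (ℕ.∸-monoʳ-< (Rotation-potential ρ) (⊑-potential p)) gap≤))))))

∑ℕ< : ℕ → (ℕ → ℕ) → ℕ
∑ℕ< m h = sum (applyUpTo h m)

∑ℕ<-count : ∀ m (h : ℕ → ℕ) → (∀ i → i < m → 1 ≤ h i) → m ≤ ∑ℕ< m h
∑ℕ<-count zero h _ = z≤n
∑ℕ<-count (suc m) h h≥1 = ℕ.+-mono-≤ (h≥1 0 (s≤s z≤n)) (∑ℕ<-count m (h ∘ suc) (λ i i<m → h≥1 (suc i) (s≤s i<m)))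

∑ℕ<-term+count : ∀ m j (h : ℕ → ℕ) → j ≤ m → (∀ i → i ≤ m → 1 ≤ h i) → h j + m ≤ ∑ℕ< (suc m) h
∑ℕ<-term+count m zero h _ h≥1 = ℕ.+-monoʳ-≤ (h 0) (∑ℕ<-count m (h ∘ suc) (λ i i<m → h≥1 (suc i) i<m))
∑ℕ<-term+count (suc m) (suc j) h (s≤s j≤m) h≥1 =
  subst (_≤ ∑ℕ< (suc (suc m)) h) (sym (ℕ.+-suc (h (suc j)) m))
        (ℕ.+-mono-≤ (h≥1 0 z≤n) (∑ℕ<-term+count m j (h ∘ suc) j≤m (λ i i≤m → h≥1 (suc i) (s≤s i≤m))))

length-concatMap-map : {A B C : Set} (f : A → B → C) (xs : List A) (ys : List B) →
  length (concatMap (λ x → map (f x) ys) xs) ≡ length xs * length ys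
length-concatMap-map f [] ys = refl
length-concatMap-map f (x ∷ xs) ys =
  trans (List.length-++ (map (f x) ys)) (cong₂ _+_ (List.length-map (f x) ys) (length-concatMap-map f xs ys))

length-concatMap : {A B : Set} (g : A → List B) (xs : List A) → length (concatMap g xs) ≡ sum (map (length ∘ g) xs)
length-concatMap g [] = refl
length-concatMap g (x ∷ xs) = trans (List.length-++ (g x)) (cong (length (g x) +_) (length-concatMap g xs))

length-treesF-suc : ∀ f m →
  length (treesF (suc f) (suc m)) ≡ ∑ℕ< (suc m) (λ i → length (treesF f i) * length (treesF f (m ∸ i)))
length-treesF-suc f m = begin
  length (concatMap G (upTo (suc m)))   ≡⟨ length-concatMap G (upTo (suc m)) ⟩
  sum (map (length ∘ G) (upTo (suc m))) ≡⟨ cong sum (List.map-cong (λ i → length-concatMap-map node (treesF f i) (treesF f (m ∸ i))) (upTo (suc m))) ⟩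
  sum (map H (upTo (suc m)))            ≡⟨ cong sum (List.map-upTo H (suc m)) ⟩
  ∑ℕ< (suc m) H                         ∎
  where
  open ≡-Reasoning
  G : ℕ → List Tree
  G i = concatMap (λ l → map (node l) (treesF f (m ∸ i))) (treesF f i)
  H : ℕ → ℕ
  H i = length (treesF f i) * length (treesF f (m ∸ i))

treesF-nonempty : ∀ f n → n ≤ f → 1 ≤ length (treesF f n)
treesF-nonempty f zero _ = s≤s z≤n
treesF-nonempty (suc f) (suc m) (s≤s m≤f) = subst (1 ≤_) (sym (length-treesF-suc f m))
  (ℕ.≤-trans (ℕ.*-mono-≤ (treesF-nonempty f 0 z≤n) (treesF-nonempty f m m≤f)) (ℕ.m≤m+n _ _))

m+n<[1+m]*[1+n] : ∀ m n → m + n < suc m * suc n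
m+n<[1+m]*[1+n] m n = subst (m + n <_) (expand m n) (s≤s (ℕ.m≤m+n (m + n) (m * n)))
  where
  expand : ∀ m n → suc (m + n + m * n) ≡ suc m * suc n
  expand = solve-∀

potential<length-treesF : ∀ f t → size t ≤ f → potential t < length (treesF f (size t))
potential<length-treesF f leaf _ = s≤s z≤n
potential<length-treesF (suc f) (node l r) (s≤s n≤f) = subst (potential (node l r) <_) (sym (length-treesF-suc f n)) (begin-strict
  potential l + potential r + size r     <⟨ ℕ.+-monoˡ-≤ (size r) (m+n<[1+m]*[1+n] (potential l) (potential r)) ⟩
  suc (potential l) * suc (potential r) + size r  ≤⟨ ℕ.+-mono-≤ product-bound (ℕ.m≤n+m (size r) (size l)) ⟩
  H (size l) + n                         ≤⟨ ∑ℕ<-term+count n (size l) H (ℕ.m≤m+n (size l) (size r)) H≥1 ⟩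
  ∑ℕ< (suc n) H                          ∎)
  where
  open ℕ.≤-Reasoning
  n : ℕ
  n = size l + size r
  H : ℕ → ℕ
  H i = length (treesF f i) * length (treesF f (n ∸ i))
  H≥1 : ∀ i → i ≤ n → 1 ≤ H i
  H≥1 i i≤n = ℕ.*-mono-≤ (treesF-nonempty f i (ℕ.≤-trans i≤n n≤f)) (treesF-nonempty f (n ∸ i) (ℕ.≤-trans (ℕ.m∸n≤m n i) n≤f))
  product-bound : suc (potential l) * suc (potential r) ≤ H (size l)
  product-bound = ℕ.*-mono-≤ (potential<length-treesF f l (ℕ.≤-trans (ℕ.m≤m+n (size l) (size r)) n≤f))
    (subst (λ k → suc (potential r) ≤ length (treesF f k)) (sym (ℕ.m+n∸m≡n (size l) (size r)))
      (potential<length-treesF f r (ℕ.≤-trans (ℕ.m≤n+m (size r) (size l)) n≤f)))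

potential<∣trees∣ : ∀ t → potential t < length (trees (size t))
potential<∣trees∣ t = potential<length-treesF (size t) t ℕ.≤-refl

leqT-reflects : ∀ s t → Reflects (s ⊑ t) (leqT s t)
leqT-reflects s t = fromEquivalence (reachF-sound (length (trees (size s))) s t) λ s⊑t → reachF-complete (length (trees (size s))) s⊑t
  (ℕ.≤-trans (ℕ.m∸n≤m (potential t) (potential s))
    (ℕ.<⇒≤ (subst (λ k → potential t < length (trees k)) (sym (⊑-size s⊑t)) (potential<∣trees∣ t))))

leqT-refl : ∀ t → leqT t t ≡ true
leqT-refl t = reflects-true (leqT-reflects t t) ε

-- The Möbius function and the monomial basis

filterB-true : {A : Set} (p : A → Bool) (xs : List A) → All (λ x → p x ≡ true) (filterB p xs)
filterB-true p [] = []
filterB-true p (x ∷ xs) with p x in px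
... | true = px ∷ filterB-true p xs
... | false = filterB-true p xs

-- The interval [t, s) that mobF sums over, written exactly as its filter predicate.
halfOpen : Tree → Tree → Tree → Bool
halfOpen t s u = leqT t u ∧ leqT u s ∧ (if u ==T s then false else true)

halfOpen-sound : ∀ t s u → halfOpen t s u ≡ true → t ⊑ u × u ⊑ s × u ≢ s
halfOpen-sound t s u h with leqT t u | leqT-reflects t u | leqT u s | leqT-reflects u s | u ==T s | ==T-reflects u s
... | true | ofʸ t⊑u | true | ofʸ u⊑s | false | ofⁿ u≢s = t⊑u , u⊑s , u≢s
halfOpen-sound t s u () | true | _ | true | _ | true | _
halfOpen-sound t s u () | true | _ | false | _ | _ | _
halfOpen-sound t s u () | false | _ | _ | _ | _ | _

mobF-fuel : ∀ f g t s → potential s ∸ potential t < f → potential s ∸ potential t < g → mobF f t s ≡ mobF g t s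
mobF-fuel (suc f) (suc g) t s (s≤s gap≤f) (s≤s gap≤g) with t ==T s
... | true = refl
... | false with leqT t s
...   | false = refl
...   | true = cong (-_ ∘ sumℚ) (List.map-cong-local (Amap refuel (filterB-true (halfOpen t s) (trees (size t)))))
  where
  refuel : ∀ {u} → halfOpen t s u ≡ true → mobF f t u ≡ mobF g t u
  refuel {u} h with halfOpen-sound t s u h
  ... | t⊑u , u⊑s , u≢s = mobF-fuel f g t u (ℕ.<-≤-trans gap< gap≤f) (ℕ.<-≤-trans gap< gap≤g)
    where
    gap< : potential u ∸ potential t < potential s ∸ potential t
    gap< = ℕ.∸-monoˡ-< (⊑-potential-< u⊑s u≢s) (⊑-potential t⊑u)

mobF-∣trees∣ : ∀ t u → size u ≡ size t → mobF (length (trees (size t))) t u ≡ mob t u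
mobF-∣trees∣ t u su = mobF-fuel _ _ t u gap< (ℕ.m<n⇒m<1+n gap<)
  where
  gap< : potential u ∸ potential t < length (trees (size t))
  gap< = ℕ.≤-<-trans (ℕ.m∸n≤m (potential u) (potential t))
                     (subst (λ k → potential u < length (trees k)) su (potential<∣trees∣ u))

mob-refl : ∀ t → mob t t ≡ 1ℚ
mob-refl t rewrite ==T-refl t = refl

mob-recursion : ∀ t s → t ⊑ s → t ≢ s →
  mob t s ≡ - ∑ (trees (size t)) (λ u → when (halfOpen t s u) (mob t u))
mob-recursion t s t⊑s t≢s = begin
  mob t s
    ≡⟨ cong₂ (λ b c → if b then 1ℚ else (if c then unfolded else 0ℚ))
             (reflects-false (==T-reflects t s) t≢s) (reflects-true (leqT-reflects t s) t⊑s) ⟩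
  unfolded
    ≡⟨ cong -_ (∑-filterB (halfOpen t s) (trees (size t)) (mobF (length (trees (size t))) t)) ⟩
  - ∑ (trees (size t)) (λ u → when (halfOpen t s u) (mobF (length (trees (size t))) t u))
    ≡⟨ cong -_ (∑-cong-local (trees (size t)) (trees-sized (size t)) λ u su → cong (when (halfOpen t s u)) (mobF-∣trees∣ t u su)) ⟩
  - ∑ (trees (size t)) (λ u → when (halfOpen t s u) (mob t u)) ∎
  where
  open ≡-Reasoning
  unfolded : ℚ
  unfolded = - ∑ (filterB (halfOpen t s) (trees (size t))) (mobF (length (trees (size t))) t)

coeffM : Tree → Tree → ℚ
coeffM t s = when (leqT t s) (mob t s)

coeffM-refl : ∀ t → coeffM t t ≡ 1ℚ
coeffM-refl t = trans (cong (λ b → when b (mob t t)) (leqT-refl t)) (mob-refl t)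

coeffM-⋢ : ∀ t s → ¬ t ⊑ s → coeffM t s ≡ 0ℚ
coeffM-⋢ t s t⋢s = cong (λ b → when b (mob t s)) (reflects-false (leqT-reflects t s) t⋢s)

coeffM-size : ∀ t s → size t ≢ size s → coeffM t s ≡ 0ℚ
coeffM-size t s t≉s = coeffM-⋢ t s (t≉s ∘ ⊑-size)

when-split : ∀ a b c (q : ℚ) → (c ≡ true → b ≡ true) →
  when b (when a q) ≡ when c (when a q) +ℚ when (a ∧ b ∧ (if c then false else true)) q
when-split true  b true  q c⇒b rewrite c⇒b refl = sym (ℚ.+-identityʳ q)
when-split false b true  q c⇒b rewrite c⇒b refl = sym (ℚ.+-identityʳ 0ℚ)
when-split true  true  false q _ = sym (ℚ.+-identityˡ q)
when-split true  false false q _ = sym (ℚ.+-identityˡ 0ℚ)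
when-split false true  false q _ = sym (ℚ.+-identityˡ 0ℚ)
when-split false false false q _ = sym (ℚ.+-identityˡ 0ℚ)

∑-coeffM-below-refl : ∀ t → ∑ (trees (size t)) (λ u → when (leqT u t) (coeffM t u)) ≡ 1ℚ
∑-coeffM-below-refl t = begin
  ∑ (trees (size t)) (λ u → when (leqT u t) (when (leqT t u) (mob t u)))
    ≡⟨ ∑-cong (trees (size t)) only-t ⟩
  ∑ (trees (size t)) (λ u → when (u ==T t) (mob t u))
    ≡⟨ ∑-trees-pick (size t) t refl (mob t) ⟩
  mob t t
    ≡⟨ mob-refl t ⟩
  1ℚ ∎
  where
  open ≡-Reasoning
  only-t : ∀ u → when (leqT u t) (when (leqT t u) (mob t u)) ≡ when (u ==T t) (mob t u)
  only-t u with u ==T t | ==T-reflects u t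
  ... | true | ofʸ refl rewrite leqT-refl u = refl
  ... | false | ofⁿ u≢t with leqT u t | leqT-reflects u t | leqT t u | leqT-reflects t u
  ...   | true  | ofʸ u⊑t | true  | ofʸ t⊑u = ⊥-elim (u≢t (⊑-antisym u⊑t t⊑u))
  ...   | true  | _       | false | _       = refl
  ...   | false | _       | _     | _       = refl

∑-coeffM-below-⋢ : ∀ n t s → ¬ t ⊑ s → ∑ (trees n) (λ u → when (leqT u s) (coeffM t u)) ≡ 0ℚ
∑-coeffM-below-⋢ n t s t⋢s = ∑-zero (trees n) vanish
  where
  vanish : ∀ u → when (leqT u s) (when (leqT t u) (mob t u)) ≡ 0ℚ
  vanish u with leqT u s | leqT-reflects u s | leqT t u | leqT-reflects t u
  ... | true  | ofʸ u⊑s | true  | ofʸ t⊑u = ⊥-elim (t⋢s (t⊑u ◅◅ u⊑s))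
  ... | true  | _       | false | _       = refl
  ... | false | _       | _     | _       = refl

∑-coeffM-below-⊏ : ∀ t s → t ⊑ s → t ≢ s → ∑ (trees (size t)) (λ u → when (leqT u s) (coeffM t u)) ≡ 0ℚ
∑-coeffM-below-⊏ t s t⊑s t≢s = begin
  ∑ (trees n) (λ u → when (leqT u s) (when (leqT t u) (mob t u)))
    ≡⟨ ∑-cong (trees n) (λ u → when-split (leqT t u) (leqT u s) (u ==T s) (mob t u) (u=s⇒u⊑s u)) ⟩
  ∑ (trees n) (λ u → when (u ==T s) (coeffM t u) +ℚ when (halfOpen t s u) (mob t u))
    ≡⟨ ∑-distrib-+ (trees n) (λ u → when (u ==T s) (coeffM t u)) (λ u → when (halfOpen t s u) (mob t u)) ⟩
  ∑ (trees n) (λ u → when (u ==T s) (coeffM t u)) +ℚ S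
    ≡⟨ cong (_+ℚ S) (trans (∑-trees-pick n s (sym (⊑-size t⊑s)) (coeffM t))
                           (cong (λ b → when b (mob t s)) (reflects-true (leqT-reflects t s) t⊑s))) ⟩
  mob t s +ℚ S
    ≡⟨ cong (_+ℚ S) (mob-recursion t s t⊑s t≢s) ⟩
  - S +ℚ S
    ≡⟨ ℚ.+-inverseˡ S ⟩
  0ℚ ∎
  where
  open ≡-Reasoning
  n : ℕ
  n = size t
  S : ℚ
  S = ∑ (trees n) (λ u → when (halfOpen t s u) (mob t u))
  u=s⇒u⊑s : ∀ u → (u ==T s) ≡ true → leqT u s ≡ true
  u=s⇒u⊑s u u=s with reflects-sound (==T-reflects u s) u=s
  ... | refl = leqT-refl u

-- The recursion defining μ, read as Σ_{t ≤ u ≤ s} μ(t,u) = [t = s].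
∑-coeffM-below : ∀ n t s → size s ≡ n → ∑ (trees n) (λ u → when (leqT u s) (coeffM t u)) ≡ 𝟙 (t ==T s)
∑-coeffM-below n t s refl with t ==T s | ==T-reflects t s
... | true  | ofʸ refl = ∑-coeffM-below-refl t
... | false | ofⁿ t≢s with leqT t s | leqT-reflects t s
...   | false | ofⁿ t⋢s = ∑-coeffM-below-⋢ (size s) t s t⋢s
...   | true  | ofʸ t⊑s rewrite sym (⊑-size t⊑s) = ∑-coeffM-below-⊏ t s t⊑s t≢s

-- Cutting a tree after its first i nodes

-- takeTree i t and dropTree i t are λ(st(γ(t)(1..i))) and λ(st(γ(t)(i+1..n))), see ΔF-split.
takeTree : ℕ → Tree → Tree
takeTree i leaf = leaf
takeTree i (node l r) = if i ≤ᵇ size l then takeTree i l else node l (takeTree (i ∸ suc (size l)) r)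

dropTree : ℕ → Tree → Tree
dropTree i leaf = leaf
dropTree i (node l r) = if i ≤ᵇ size l then node (dropTree i l) r else dropTree (i ∸ suc (size l)) r

module _ {i : ℕ} (l r : Tree) where

  private
    ≤ᵇ-true : i ≤ size l → (i ≤ᵇ size l) ≡ true
    ≤ᵇ-true = reflects-true (ℕ.≤ᵇ-reflects-≤ i (size l))

    ≤ᵇ-false : size l < i → (i ≤ᵇ size l) ≡ false
    ≤ᵇ-false l<i = reflects-false (ℕ.≤ᵇ-reflects-≤ i (size l)) (ℕ.<⇒≱ l<i)

  takeTree-≤ : i ≤ size l → takeTree i (node l r) ≡ takeTree i l
  takeTree-≤ i≤l = cong (if_then takeTree i l else node l (takeTree (i ∸ suc (size l)) r)) (≤ᵇ-true i≤l)

  takeTree-> : size l < i → takeTree i (node l r) ≡ node l (takeTree (i ∸ suc (size l)) r)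
  takeTree-> l<i = cong (if_then takeTree i l else node l (takeTree (i ∸ suc (size l)) r)) (≤ᵇ-false l<i)

  dropTree-≤ : i ≤ size l → dropTree i (node l r) ≡ node (dropTree i l) r
  dropTree-≤ i≤l = cong (if_then node (dropTree i l) r else dropTree (i ∸ suc (size l)) r) (≤ᵇ-true i≤l)

  dropTree-> : size l < i → dropTree i (node l r) ≡ dropTree (i ∸ suc (size l)) r
  dropTree-> l<i = cong (if_then node (dropTree i l) r else dropTree (i ∸ suc (size l)) r) (≤ᵇ-false l<i)

size-takeTree+dropTree : ∀ i t → size (takeTree i t) + size (dropTree i t) ≡ size t
size-takeTree+dropTree i leaf = refl
size-takeTree+dropTree i (node l r) with ℕ.≤-<-connex i (size l)
... | inj₁ i≤l rewrite takeTree-≤ l r i≤l | dropTree-≤ l r i≤l = begin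
  size (takeTree i l) + suc (size (dropTree i l) + size r)   ≡⟨ ℕ.+-suc _ _ ⟩
  suc (size (takeTree i l) + (size (dropTree i l) + size r)) ≡⟨ cong suc (ℕ.+-assoc (size (takeTree i l)) (size (dropTree i l)) (size r)) ⟨
  suc (size (takeTree i l) + size (dropTree i l) + size r)   ≡⟨ cong (λ k → suc (k + size r)) (size-takeTree+dropTree i l) ⟩
  suc (size l + size r)                                      ∎
  where open ≡-Reasoning
... | inj₂ l<i rewrite takeTree-> l r l<i | dropTree-> l r l<i =
  cong suc (trans (ℕ.+-assoc (size l) _ _) (cong (size l +_) (size-takeTree+dropTree (i ∸ suc (size l)) r)))

size-takeTree : ∀ i t → i ≤ size t → size (takeTree i t) ≡ i
size-takeTree i leaf z≤n = refl
size-takeTree i (node l r) i≤t with ℕ.≤-<-connex i (size l)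
... | inj₁ i≤l rewrite takeTree-≤ l r i≤l = size-takeTree i l i≤l
... | inj₂ l<i rewrite takeTree-> l r l<i =
  trans (cong (λ k → suc (size l + k)) (size-takeTree (i ∸ suc (size l)) r rest≤r)) (ℕ.m+[n∸m]≡n l<i)
  where
  rest≤r : i ∸ suc (size l) ≤ size r
  rest≤r = subst (i ∸ suc (size l) ≤_) (ℕ.m+n∸m≡n (suc (size l)) (size r)) (ℕ.∸-monoˡ-≤ (suc (size l)) i≤t)

size-dropTree : ∀ i t → i ≤ size t → size (dropTree i t) ≡ size t ∸ i
size-dropTree i t i≤t = trans (sym (ℕ.m+n∸m≡n (size (takeTree i t)) (size (dropTree i t))))
                              (cong₂ _∸_ (size-takeTree+dropTree i t) (size-takeTree i t i≤t))

size-＼ : ∀ s u → size (s ＼ u) ≡ size s + size u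
size-＼ leaf u = refl
size-＼ (node a b) u = cong suc (trans (cong (size a +_) (size-＼ b u)) (sym (ℕ.+-assoc (size a) _ _)))

takeTree-0 : ∀ t → takeTree 0 t ≡ leaf
takeTree-0 leaf = refl
takeTree-0 (node l r) = trans (takeTree-≤ l r z≤n) (takeTree-0 l)

dropTree-0 : ∀ t → dropTree 0 t ≡ t
dropTree-0 leaf = refl
dropTree-0 (node l r) = trans (dropTree-≤ l r z≤n) (cong (λ x → node x r) (dropTree-0 l))

takeTree-＼ : ∀ s u → takeTree (size s) (s ＼ u) ≡ s
takeTree-＼ leaf u = takeTree-0 u
takeTree-＼ (node a b) u = trans (takeTree-> a (b ＼ u) (s≤s (ℕ.m≤m+n (size a) (size b))))
  (cong (node a) (subst (λ k → takeTree k (b ＼ u) ≡ b) (sym (ℕ.m+n∸m≡n (size a) (size b))) (takeTree-＼ b u)))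

dropTree-＼ : ∀ s u → dropTree (size s) (s ＼ u) ≡ u
dropTree-＼ leaf u = dropTree-0 u
dropTree-＼ (node a b) u = trans (dropTree-> a (b ＼ u) (s≤s (ℕ.m≤m+n (size a) (size b))))
  (subst (λ k → dropTree k (b ＼ u) ≡ u) (sym (ℕ.m+n∸m≡n (size a) (size b))) (dropTree-＼ b u))

＼-monoˡ : ∀ {u u'} v → u ⊑ u' → u ＼ v ⊑ u' ＼ v
＼-monoˡ v = kleisliStar (_＼ v) step
  where
  step : ∀ {s t} → Rotation s t → s ＼ v ⊑ t ＼ v
  step (rotate a b c) = rotate a b (c ＼ v) ◅ ε
  step (rotateˡ r ρ) = rotateˡ (r ＼ v) ρ ◅ ε
  step (rotateʳ l ρ) = ⊑-nodeʳ l (step ρ)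

＼-monoʳ : ∀ u {v v'} → v ⊑ v' → u ＼ v ⊑ u ＼ v'
＼-monoʳ leaf p = p
＼-monoʳ (node a b) p = ⊑-nodeʳ a (＼-monoʳ b p)

node-＼-⊑ : ∀ x y r → node (x ＼ y) r ⊑ x ＼ node y r
node-＼-⊑ leaf y r = ε
node-＼-⊑ (node x₁ x₂) y r = rotate x₁ (x₂ ＼ y) r ◅ ⊑-nodeʳ x₁ (node-＼-⊑ x₂ y r)

⊑-takeTree-＼-dropTree : ∀ i t → t ⊑ takeTree i t ＼ dropTree i t
⊑-takeTree-＼-dropTree i leaf = ε
⊑-takeTree-＼-dropTree i (node l r) with ℕ.≤-<-connex i (size l)
... | inj₁ i≤l rewrite takeTree-≤ l r i≤l | dropTree-≤ l r i≤l =
  ⊑-nodeˡ r (⊑-takeTree-＼-dropTree i l) ◅◅ node-＼-⊑ (takeTree i l) (dropTree i l) r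
... | inj₂ l<i rewrite takeTree-> l r l<i | dropTree-> l r l<i =
  ⊑-nodeʳ l (⊑-takeTree-＼-dropTree (i ∸ suc (size l)) r)

private
  ∸-suc-≤ : ∀ {i a b} → i ≤ suc (a + b) → i ∸ suc a ≤ b
  ∸-suc-≤ {i} {a} {b} i≤ab = subst (i ∸ suc a ≤_) (ℕ.m+n∸m≡n (suc a) b) (ℕ.∸-monoˡ-≤ (suc a) i≤ab)

  ∸-suc-> : ∀ {i a b} → suc (a + b) < i → b < i ∸ suc a
  ∸-suc-> {i} {a} {b} ab<i = subst (_< i ∸ suc a) (ℕ.m+n∸m≡n (suc a) b) (ℕ.∸-monoˡ-< ab<i (ℕ.m≤m+n (suc a) b))

  ∸-∸-suc : ∀ i a b → i ∸ suc a ∸ suc b ≡ i ∸ suc (suc (a + b))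
  ∸-∸-suc i a b = trans (ℕ.∸-+-assoc i (suc a) (suc b)) (cong (λ k → i ∸ suc k) (ℕ.+-suc a b))

takeTree-dropTree-Rotation : ∀ i {t t'} → Rotation t t' → takeTree i t ⊑ takeTree i t' × dropTree i t ⊑ dropTree i t'
takeTree-dropTree-Rotation i (rotate a b c) with ℕ.≤-<-connex i (size a)
... | inj₁ i≤a
  rewrite takeTree-≤ (node a b) c (ℕ.≤-trans i≤a (ℕ.≤-trans (ℕ.m≤m+n (size a) (size b)) (ℕ.n≤1+n _)))
        | takeTree-≤ a b i≤a | takeTree-≤ a (node b c) i≤a
        | dropTree-≤ (node a b) c (ℕ.≤-trans i≤a (ℕ.≤-trans (ℕ.m≤m+n (size a) (size b)) (ℕ.n≤1+n _)))
        | dropTree-≤ a b i≤a | dropTree-≤ a (node b c) i≤a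
  = ε , rotate (dropTree i a) b c ◅ ε
... | inj₂ a<i with ℕ.≤-<-connex i (suc (size a + size b))
...   | inj₁ i≤ab
  rewrite takeTree-≤ (node a b) c i≤ab | takeTree-> a b a<i | takeTree-> a (node b c) a<i
        | dropTree-≤ (node a b) c i≤ab | dropTree-> a b a<i | dropTree-> a (node b c) a<i
        | takeTree-≤ b c (∸-suc-≤ {i} {size a} {size b} i≤ab) | dropTree-≤ b c (∸-suc-≤ {i} {size a} {size b} i≤ab)
  = ε , ε
...   | inj₂ ab<i
  rewrite takeTree-> (node a b) c ab<i | takeTree-> a (node b c) a<i | takeTree-> b c (∸-suc-> {i} {size a} {size b} ab<i)
        | dropTree-> (node a b) c ab<i | dropTree-> a (node b c) a<i | dropTree-> b c (∸-suc-> {i} {size a} {size b} ab<i)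
        | ∸-∸-suc i (size a) (size b)
  = rotate a b _ ◅ ε , ε
takeTree-dropTree-Rotation i (rotateˡ {l} {l'} r ρ) with ℕ.≤-<-connex i (size l)
... | inj₁ i≤l
  rewrite takeTree-≤ l r i≤l | dropTree-≤ l r i≤l
        | takeTree-≤ l' r (subst (i ≤_) (Rotation-size ρ) i≤l) | dropTree-≤ l' r (subst (i ≤_) (Rotation-size ρ) i≤l)
  = proj₁ (takeTree-dropTree-Rotation i ρ) , ⊑-nodeˡ r (proj₂ (takeTree-dropTree-Rotation i ρ))
... | inj₂ l<i
  rewrite takeTree-> l r l<i | dropTree-> l r l<i
        | takeTree-> l' r (subst (_< i) (Rotation-size ρ) l<i) | dropTree-> l' r (subst (_< i) (Rotation-size ρ) l<i)
        | sym (Rotation-size ρ)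
  = rotateˡ _ ρ ◅ ε , ε
takeTree-dropTree-Rotation i (rotateʳ l {r} {r'} ρ) with ℕ.≤-<-connex i (size l)
... | inj₁ i≤l rewrite takeTree-≤ l r i≤l | dropTree-≤ l r i≤l | takeTree-≤ l r' i≤l | dropTree-≤ l r' i≤l =
  ε , rotateʳ _ ρ ◅ ε
... | inj₂ l<i rewrite takeTree-> l r l<i | dropTree-> l r l<i | takeTree-> l r' l<i | dropTree-> l r' l<i =
  ⊑-nodeʳ l (proj₁ (takeTree-dropTree-Rotation _ ρ)) , proj₂ (takeTree-dropTree-Rotation _ ρ)

takeTree-mono : ∀ i {t t'} → t ⊑ t' → takeTree i t ⊑ takeTree i t'
takeTree-mono i = kleisliStar (takeTree i) (proj₁ ∘ takeTree-dropTree-Rotation i)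

dropTree-mono : ∀ i {t t'} → t ⊑ t' → dropTree i t ⊑ dropTree i t'
dropTree-mono i = kleisliStar (dropTree i) (proj₂ ∘ takeTree-dropTree-Rotation i)

⊑-＼-galois : ∀ w s u → w ⊑ s ＼ u ⇔ (takeTree (size s) w ⊑ s × dropTree (size s) w ⊑ u)
⊑-＼-galois w s u = mk⇔
  (λ w⊑su → subst (takeTree (size s) w ⊑_) (takeTree-＼ s u) (takeTree-mono (size s) w⊑su)
          , subst (dropTree (size s) w ⊑_) (dropTree-＼ s u) (dropTree-mono (size s) w⊑su))
  (λ (p , q) → ⊑-takeTree-＼-dropTree (size s) w ◅◅ ＼-monoˡ (dropTree (size s) w) p ◅◅ ＼-monoʳ s q)

-- Standardisation, λ and γ

countB-++ : {A : Set} (p : A → Bool) (xs ys : List A) → countB p (xs ++ ys) ≡ countB p xs + countB p ys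
countB-++ p [] ys = refl
countB-++ p (x ∷ xs) ys with p x
... | true = cong suc (countB-++ p xs ys)
... | false = countB-++ p xs ys

countB-all : {A : Set} (p : A → Bool) (xs : List A) → All (λ x → p x ≡ true) xs → countB p xs ≡ length xs
countB-all p [] [] = refl
countB-all p (x ∷ xs) (px ∷ pxs) rewrite px = cong suc (countB-all p xs pxs)

countB-≤ : {A : Set} (p : A → Bool) (xs : List A) → countB p xs ≤ length xs
countB-≤ p [] = z≤n
countB-≤ p (x ∷ xs) with p x
... | true = s≤s (countB-≤ p xs)
... | false = ℕ.m≤n⇒m≤1+n (countB-≤ p xs)

countB-< : {A : Set} (p : A → Bool) {y : A} (xs : List A) → y ∈ xs → p y ≡ false → countB p xs < length xs
countB-< p (x ∷ xs) (here refl) py rewrite py = s≤s (countB-≤ p xs)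
countB-< p (x ∷ xs) (there y∈) py with p x
... | true = s≤s (countB-< p xs y∈ py)
... | false = ℕ.m≤n⇒m≤1+n (countB-< p xs y∈ py)

countB-mono : {A : Set} (p q : A → Bool) → (∀ x → p x ≡ true → q x ≡ true) → (xs : List A) → countB p xs ≤ countB q xs
countB-mono p q p⇒q [] = z≤n
countB-mono p q p⇒q (x ∷ xs) with p x in px | q x in qx
... | true  | true  = s≤s (countB-mono p q p⇒q xs)
... | true  | false with () ← trans (sym (p⇒q x px)) qx
... | false | true  = ℕ.m≤n⇒m≤1+n (countB-mono p q p⇒q xs)
... | false | false = countB-mono p q p⇒q xs

countB-mono-< : {A : Set} (p q : A → Bool) → (∀ x → p x ≡ true → q x ≡ true) → (xs : List A) {y : A} → y ∈ xs →
  p y ≡ false → q y ≡ true → countB p xs < countB q xs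
countB-mono-< p q p⇒q (x ∷ xs) (here refl) py qy rewrite py | qy = s≤s (countB-mono p q p⇒q xs)
countB-mono-< p q p⇒q (x ∷ xs) (there y∈) py qy with p x in px | q x in qx
... | true  | true  = s≤s (countB-mono-< p q p⇒q xs y∈ py qy)
... | true  | false with () ← trans (sym (p⇒q x px)) qx
... | false | true  = ℕ.m≤n⇒m≤1+n (countB-mono-< p q p⇒q xs y∈ py qy)
... | false | false = countB-mono-< p q p⇒q xs y∈ py qy

countB-cong-local : {A : Set} (p q : A → Bool) (xs : List A) → All (λ x → p x ≡ q x) xs → countB p xs ≡ countB q xs
countB-cong-local p q [] [] = refl
countB-cong-local p q (x ∷ xs) (px≡qx ∷ eqs) with p x | q x
countB-cong-local p q (x ∷ xs) (refl ∷ eqs) | true  | .true  = cong suc (countB-cong-local p q xs eqs)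
countB-cong-local p q (x ∷ xs) (refl ∷ eqs) | false | .false = countB-cong-local p q xs eqs

countB-map : {A B : Set} (p : B → Bool) (g : A → B) (xs : List A) → countB p (map g xs) ≡ countB (p ∘ g) xs
countB-map p g [] = refl
countB-map p g (x ∷ xs) with p (g x)
... | true = cong suc (countB-map p g xs)
... | false = countB-map p g xs

<ᵇ-true : ∀ {m n} → m < n → (m <ᵇ n) ≡ true
<ᵇ-true {m} {n} = reflects-true (ℕ.<ᵇ-reflects-< m n)

<ᵇ-false : ∀ {m n} → n ≤ m → (m <ᵇ n) ≡ false
<ᵇ-false {m} {n} n≤m = reflects-false (ℕ.<ᵇ-reflects-< m n) (ℕ.≤⇒≯ n≤m)

≡ᵇ-reflects : ∀ m n → Reflects (m ≡ n) (m ≡ᵇ n)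
≡ᵇ-reflects m n = fromEquivalence (ℕ.≡ᵇ⇒≡ m n) (ℕ.≡⇒≡ᵇ m n)

rank : List ℕ → ℕ → ℕ
rank w x = suc (countB (_<ᵇ x) w)

rank-mono : ∀ w {a b} → a ≤ b → rank w a ≤ rank w b
rank-mono w {a} {b} a≤b = s≤s (countB-mono (_<ᵇ a) (_<ᵇ b)
  (λ y y<a → <ᵇ-true (ℕ.<-≤-trans (reflects-sound (ℕ.<ᵇ-reflects-< y a) y<a) a≤b)) w)

rank-mono-< : ∀ w {a b} → b ∈ w → b < a → rank w b < rank w a
rank-mono-< w {a} {b} b∈w b<a = s≤s (countB-mono-< (_<ᵇ b) (_<ᵇ a)
  (λ y y<b → <ᵇ-true (ℕ.<-trans (reflects-sound (ℕ.<ᵇ-reflects-< y b) y<b) b<a)) w b∈w (<ᵇ-false {b} ℕ.≤-refl) (<ᵇ-true b<a))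

rank-<ᵇ : ∀ w {a b} → b ∈ w → (rank w b <ᵇ rank w a) ≡ (b <ᵇ a)
rank-<ᵇ w {a} {b} b∈w = det (ℕ.<ᵇ-reflects-< (rank w b) (rank w a)) (reflects-map
  (rank-mono-< w b∈w)
  (λ rb<ra → ℕ.≰⇒> λ a≤b → ℕ.<⇒≱ rb<ra (rank-mono w a≤b))
  (ℕ.<ᵇ-reflects-< b a))

st-map : ∀ (g : ℕ → ℕ) (A : List ℕ) → (∀ {a b} → b ∈ A → (g b <ᵇ g a) ≡ (b <ᵇ a)) → st (map g A) ≡ st A
st-map g A g-<ᵇ = trans (sym (List.map-∘ A)) (List.map-cong-local (tabulate λ {a} _ →
  cong suc (trans (countB-map (_<ᵇ g a) g A) (countB-cong-local _ _ A (tabulate g-<ᵇ)))))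

splitAtVal-++ : ∀ v (xs ys : List ℕ) → All (λ y → (y ≡ᵇ v) ≡ false) xs → splitAtVal v (xs ++ v ∷ ys) ≡ (xs , ys)
splitAtVal-++ v [] ys [] rewrite reflects-true (≡ᵇ-reflects v v) refl = refl
splitAtVal-++ v (x ∷ xs) ys (x≢v ∷ xs≢v) rewrite x≢v | splitAtVal-++ v xs ys xs≢v = refl

-- w is the infix reading of a decreasing tree of shape t: w = A x B with x above every letter of A and B.
data Shape : List ℕ → Tree → Set where
  leaf : Shape [] leaf
  node : ∀ {A B x l r} → Shape A l → Shape B r → All (_< x) A → All (_< x) B → Shape (A ++ x ∷ B) (node l r)

module MaxSplit {A B : List ℕ} {x : ℕ} (A<x : All (_< x) A) (B<x : All (_< x) B) where

  w : List ℕ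
  w = A ++ x ∷ B

  length-w : length w ≡ suc (length A + length B)
  length-w = trans (List.length-++ A) (ℕ.+-suc (length A) (length B))

  rank-max : rank w x ≡ length w
  rank-max = trans (cong suc (begin
    countB (_<ᵇ x) (A ++ x ∷ B)                      ≡⟨ countB-++ (_<ᵇ x) A (x ∷ B) ⟩
    countB (_<ᵇ x) A + countB (_<ᵇ x) (x ∷ B)        ≡⟨ cong₂ _+_ (countB-all (_<ᵇ x) A (Amap <ᵇ-true A<x)) x∷B ⟩
    length A + length B                              ∎)) (sym length-w)
    where
    open ≡-Reasoning
    x∷B : countB (_<ᵇ x) (x ∷ B) ≡ length B
    x∷B rewrite <ᵇ-false {x} ℕ.≤-refl = countB-all (_<ᵇ x) B (Amap <ᵇ-true B<x)

  rank-left-< : ∀ {a} → a ∈ A → rank w a < length w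
  rank-left-< {a} a∈A = begin-strict
    suc (countB (_<ᵇ a) (A ++ x ∷ B))                 ≡⟨ cong suc (countB-++ (_<ᵇ a) A (x ∷ B)) ⟩
    suc (countB (_<ᵇ a) A + countB (_<ᵇ a) (x ∷ B))   ≡⟨ cong (λ k → suc (countB (_<ᵇ a) A + k)) skip-x ⟩
    suc (countB (_<ᵇ a) A + countB (_<ᵇ a) B)
      <⟨ s≤s (ℕ.+-mono-<-≤ (countB-< (_<ᵇ a) A a∈A (<ᵇ-false {a} ℕ.≤-refl)) (countB-≤ (_<ᵇ a) B)) ⟩
    suc (length A + length B)                         ≡⟨ length-w ⟨
    length w                                          ∎
    where
    open ℕ.≤-Reasoning
    skip-x : countB (_<ᵇ a) (x ∷ B) ≡ countB (_<ᵇ a) B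
    skip-x rewrite <ᵇ-false {x} {a} (ℕ.<⇒≤ (Alookup A<x a∈A)) = refl

  splitAtVal-st : splitAtVal (length (st w)) (st w) ≡ (map (rank w) A , map (rank w) B)
  splitAtVal-st = begin
    splitAtVal (length (st w)) (st w)
      ≡⟨ cong (λ v → splitAtVal v (st w)) (trans (List.length-map (rank w) w) (sym rank-max)) ⟩
    splitAtVal (rank w x) (map (rank w) (A ++ x ∷ B))
      ≡⟨ cong (splitAtVal (rank w x)) (List.map-++ (rank w) A (x ∷ B)) ⟩
    splitAtVal (rank w x) (map (rank w) A ++ rank w x ∷ map (rank w) B)
      ≡⟨ splitAtVal-++ (rank w x) (map (rank w) A) (map (rank w) B) (All.map⁺ (tabulate λ {a} a∈A →
           reflects-false (≡ᵇ-reflects (rank w a) (rank w x)) (ℕ.<⇒≢ (subst (rank w a <_) (sym rank-max) (rank-left-< a∈A))))) ⟩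
    (map (rank w) A , map (rank w) B) ∎
    where open ≡-Reasoning

  st-left : st (map (rank w) A) ≡ st A
  st-left = st-map (rank w) A (λ {a} b∈A → rank-<ᵇ w {a} (∈-++⁺ˡ b∈A))

  st-right : st (map (rank w) B) ≡ st B
  st-right = st-map (rank w) B (λ {a} b∈B → rank-<ᵇ w {a} (∈-++⁺ʳ A (there b∈B)))

lamF-[] : ∀ f → lamF f [] ≡ leaf
lamF-[] zero = refl
lamF-[] (suc f) = refl

lamF-suc : ∀ f (σ : List ℕ) → 1 ≤ length σ →
  lamF (suc f) σ ≡ node (lamF f (st (proj₁ (splitAtVal (length σ) σ)))) (lamF f (st (proj₂ (splitAtVal (length σ) σ))))
lamF-suc f (x ∷ σ) _ = refl

lamF-st : ∀ f {w t} → Shape w t → length w ≤ f → lamF f (st w) ≡ t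
lamF-st f leaf _ = lamF-[] f
lamF-st zero (node {A} {B} _ _ A<x B<x) w≤0 with () ← subst (_≤ 0) (MaxSplit.length-w A<x B<x) w≤0
lamF-st (suc f) (node {A} {B} {x} {l} {r} shA shB A<x B<x) w≤f = begin
  lamF (suc f) (st w)
    ≡⟨ lamF-suc f (st w) (subst (1 ≤_) (sym (trans (List.length-map (rank w) w) length-w)) (s≤s z≤n)) ⟩
  node (lamF f (st (proj₁ (splitAtVal (length (st w)) (st w))))) (lamF f (st (proj₂ (splitAtVal (length (st w)) (st w)))))
    ≡⟨ cong (λ p → node (lamF f (st (proj₁ p))) (lamF f (st (proj₂ p)))) splitAtVal-st ⟩
  node (lamF f (st (map (rank w) A))) (lamF f (st (map (rank w) B)))
    ≡⟨ cong₂ (λ a b → node (lamF f a) (lamF f b)) st-left st-right ⟩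
  node (lamF f (st A)) (lamF f (st B))
    ≡⟨ cong₂ node (lamF-st f shA (ℕ.≤-trans (ℕ.m≤m+n _ _) AB≤f)) (lamF-st f shB (ℕ.≤-trans (ℕ.m≤n+m _ _) AB≤f)) ⟩
  node l r ∎
  where
  open ≡-Reasoning
  open MaxSplit A<x B<x
  AB≤f : length A + length B ≤ f
  AB≤f = ℕ.≤-pred (subst (_≤ suc f) length-w w≤f)

lam-st : ∀ {w t} → Shape w t → lam (st w) ≡ t
lam-st {w} sh = lamF-st (length (st w)) sh (ℕ.≤-reflexive (sym (List.length-map (rank w) w)))

length-gam : ∀ t → length (gam t) ≡ size t
length-gam leaf = refl
length-gam (node l r) = trans (List.length-++ (map (_+ length (gam r)) (gam l)))
  (trans (cong₂ (λ a b → a + suc b) (trans (List.length-map _ (gam l)) (length-gam l)) (length-gam r)) (ℕ.+-suc (size l) (size r)))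

gam-≤ : ∀ t → All (_≤ size t) (gam t)
gam-≤ leaf = []
gam-≤ (node l r) = All.++⁺
  (All.map⁺ (Amap (λ y≤l → ℕ.≤-trans (ℕ.+-mono-≤ y≤l (ℕ.≤-reflexive (length-gam r))) (ℕ.n≤1+n _)) (gam-≤ l)))
  (ℕ.≤-reflexive (cong suc (cong₂ _+_ (length-gam l) (length-gam r)))
   ∷ Amap (λ y≤r → ℕ.≤-trans y≤r (ℕ.≤-trans (ℕ.m≤n+m (size r) (size l)) (ℕ.n≤1+n _))) (gam-≤ r))

Shape-+ : ∀ q {w t} → Shape w t → Shape (map (_+ q) w) t
Shape-+ q leaf = leaf
Shape-+ q (node {A} {B} {x} shA shB A<x B<x) = subst (λ v → Shape v _) (sym (List.map-++ (_+ q) A (x ∷ B)))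
  (node (Shape-+ q shA) (Shape-+ q shB) (All.map⁺ (Amap (ℕ.+-monoˡ-< q) A<x)) (All.map⁺ (Amap (ℕ.+-monoˡ-< q) B<x)))

module GamNode (l r : Tree) where

  shifted : List ℕ
  shifted = map (_+ length (gam r)) (gam l)

  top : ℕ
  top = suc (length (gam l) + length (gam r))

  shifted<top : All (_< top) shifted
  shifted<top = All.map⁺ (Amap (λ {y} y≤l → s≤s (ℕ.+-monoˡ-≤ (length (gam r)) (subst (y ≤_) (sym (length-gam l)) y≤l))) (gam-≤ l))

  gam-r<top : All (_< top) (gam r)
  gam-r<top = Amap (λ {y} y≤r → s≤s (ℕ.≤-trans (subst (y ≤_) (sym (length-gam r)) y≤r) (ℕ.m≤n+m _ _))) (gam-≤ r)

  length-shifted : length shifted ≡ size l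
  length-shifted = trans (List.length-map _ (gam l)) (length-gam l)

Shape-gam : ∀ t → Shape (gam t) t
Shape-gam leaf = leaf
Shape-gam (node l r) = node (Shape-+ _ (Shape-gam l)) (Shape-gam r) shifted<top gam-r<top
  where open GamNode l r

take-++-≤ : {A : Set} (i : ℕ) (xs ys : List A) → i ≤ length xs → take i (xs ++ ys) ≡ take i xs
take-++-≤ zero xs ys _ = refl
take-++-≤ (suc i) (x ∷ xs) ys (s≤s i≤xs) = cong (x ∷_) (take-++-≤ i xs ys i≤xs)

take-++-≥ : {A : Set} (i : ℕ) (xs ys : List A) → length xs ≤ i → take i (xs ++ ys) ≡ xs ++ take (i ∸ length xs) ys
take-++-≥ i [] ys _ = refl
take-++-≥ (suc i) (x ∷ xs) ys (s≤s xs≤i) = cong (x ∷_) (take-++-≥ i xs ys xs≤i)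

drop-++-≤ : {A : Set} (i : ℕ) (xs ys : List A) → i ≤ length xs → drop i (xs ++ ys) ≡ drop i xs ++ ys
drop-++-≤ zero xs ys _ = refl
drop-++-≤ (suc i) (x ∷ xs) ys (s≤s i≤xs) = drop-++-≤ i xs ys i≤xs

drop-++-≥ : {A : Set} (i : ℕ) (xs ys : List A) → length xs ≤ i → drop i (xs ++ ys) ≡ drop (i ∸ length xs) ys
drop-++-≥ i [] ys _ = refl
drop-++-≥ (suc i) (x ∷ xs) ys (s≤s xs≤i) = drop-++-≥ i xs ys xs≤i

∸-suc : ∀ {n i} → n < i → i ∸ n ≡ suc (i ∸ suc n)
∸-suc {n} {suc i} (s≤s n≤i) = ℕ.+-∸-assoc 1 n≤i

Shape-take-gam : ∀ i t → Shape (take i (gam t)) (takeTree i t)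
Shape-take-gam i leaf = subst (λ v → Shape v leaf) (sym (List.take-[] i)) leaf
Shape-take-gam i (node l r) with ℕ.≤-<-connex i (size l)
... | inj₁ i≤l = subst₂ Shape
  (sym (trans (take-++-≤ i shifted (top ∷ gam r) (subst (i ≤_) (sym length-shifted) i≤l)) (List.take-map i (gam l))))
  (sym (takeTree-≤ l r i≤l))
  (Shape-+ _ (Shape-take-gam i l))
  where open GamNode l r
... | inj₂ l<i = subst₂ Shape
  (sym (trans (take-++-≥ i shifted (top ∷ gam r) (ℕ.≤-trans (ℕ.≤-reflexive length-shifted) (ℕ.<⇒≤ l<i)))
              (cong (λ k → shifted ++ take k (top ∷ gam r)) (trans (cong (i ∸_) length-shifted) (∸-suc l<i)))))
  (sym (takeTree-> l r l<i))
  (node (Shape-+ _ (Shape-gam l)) (Shape-take-gam (i ∸ suc (size l)) r) shifted<top (All.take⁺ (i ∸ suc (size l)) gam-r<top))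
  where open GamNode l r

Shape-drop-gam : ∀ i t → Shape (drop i (gam t)) (dropTree i t)
Shape-drop-gam i leaf = subst (λ v → Shape v leaf) (sym (List.drop-[] i)) leaf
Shape-drop-gam i (node l r) with ℕ.≤-<-connex i (size l)
... | inj₁ i≤l = subst₂ Shape
  (sym (trans (drop-++-≤ i shifted (top ∷ gam r) (subst (i ≤_) (sym length-shifted) i≤l))
              (cong (_++ top ∷ gam r) (List.drop-map i (gam l)))))
  (sym (dropTree-≤ l r i≤l))
  (node (Shape-+ _ (Shape-drop-gam i l)) (Shape-gam r) (subst (All (_< top)) (List.drop-map i (gam l)) (All.drop⁺ i shifted<top)) gam-r<top)
  where open GamNode l r
... | inj₂ l<i = subst₂ Shape
  (sym (trans (drop-++-≥ i shifted (top ∷ gam r) (ℕ.≤-trans (ℕ.≤-reflexive length-shifted) (ℕ.<⇒≤ l<i)))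
              (cong (λ k → drop k (top ∷ gam r)) (trans (cong (i ∸_) length-shifted) (∸-suc l<i)))))
  (sym (dropTree-> l r l<i))
  (Shape-drop-gam (i ∸ suc (size l)) r)
  where open GamNode l r

ΔF-split : ∀ t → ΔF t ≡ map (λ i → (1ℚ , takeTree i t , dropTree i t)) (upTo (suc (size t)))
ΔF-split t = List.map-cong (λ i → cong₂ (λ a b → (1ℚ , a , b)) (lam-st (Shape-take-gam i t)) (lam-st (Shape-drop-gam i t)))
                           (upTo (suc (size t)))

evalY : YElt → (Tree → ℚ) → ℚ
evalY y h = ∑ y (λ p → proj₁ p *ℚ h (proj₂ p))

evalYY : YYElt → (Tree → Tree → ℚ) → ℚ
evalYY z h = ∑ z (λ p → proj₁ p *ℚ h (proj₁ (proj₂ p)) (proj₂ (proj₂ p)))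

δ₁ : Tree → Tree → ℚ
δ₁ s w = 𝟙 (w ==T s)

δ₂ : Tree → Tree → Tree → Tree → ℚ
δ₂ s u a b = 𝟙 ((a ==T s) ∧ (b ==T u))

coeffF-evalY : ∀ y t → coeffF y t ≡ evalY y (δ₁ t)
coeffF-evalY y t = ∑-cong y (λ p → sym (*-𝟙 (proj₂ p ==T t) (proj₁ p)))

coeffFF-evalYY : ∀ z s u → coeffFF z s u ≡ evalYY z (δ₂ s u)
coeffFF-evalYY z s u = ∑-cong z (λ p → sym (*-𝟙 _ (proj₁ p)))

evalY-scaleY : ∀ c y h → evalY (scaleY c y) h ≡ c *ℚ evalY y h
evalY-scaleY c y h = trans (∑-map _ y _) (trans (∑-cong y (λ p → ℚ.*-assoc c (proj₁ p) _)) (∑-*ˡ y c _))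

evalYY-scaleYY : ∀ c z h → evalYY (scaleYY c z) h ≡ c *ℚ evalYY z h
evalYY-scaleYY c z h = trans (∑-map _ z _) (trans (∑-cong z (λ p → ℚ.*-assoc c (proj₁ p) _)) (∑-*ˡ z c _))

evalY-*ˡ : ∀ y c (h : Tree → ℚ) → evalY y (λ w → c *ℚ h w) ≡ c *ℚ evalY y h
evalY-*ˡ y c h = trans (∑-cong y (λ p → *-Props.x∙yz≈y∙xz (proj₁ p) c (h (proj₂ p)))) (∑-*ˡ y c _)

evalY-*ʳ : ∀ y c (h : Tree → ℚ) → evalY y (λ w → h w *ℚ c) ≡ evalY y h *ℚ c
evalY-*ʳ y c h = trans (∑-cong y (λ p → sym (ℚ.*-assoc (proj₁ p) _ c))) (∑-*ʳ y c _)

evalY-M : ∀ t h → evalY (M t) h ≡ ∑ (trees (size t)) (λ w → coeffM t w *ℚ h w)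
evalY-M t h = trans (∑-map _ (filterB (leqT t) (trees (size t))) _)
  (trans (∑-filterB (leqT t) (trees (size t)) _) (∑-cong (trees (size t)) (λ w → sym (when-* (leqT t w) (mob t w) (h w)))))

evalY-M-δ₁ : ∀ t s → evalY (M t) (δ₁ s) ≡ coeffM t s
evalY-M-δ₁ t s = trans (evalY-M t (δ₁ s)) (trans (∑-cong (trees (size t)) (λ w → *-𝟙 (w ==T s) (coeffM t w)))
  (∑-trees-pick-vanishing (size t) s (coeffM t) (λ s≉t → coeffM-size t s (s≉t ∘ sym))))

evalY-φ : ∀ x h → evalY (φ x) h ≡ ∑ x (λ p → proj₁ p *ℚ evalY (M (over (proj₂ p))) h)
evalY-φ x h = trans (∑-concatMap _ x _) (∑-cong x (λ p → evalY-scaleY (proj₁ p) (M (over (proj₂ p))) h))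

φF : QElt → Tree → ℚ
φF x w = ∑ x (λ p → proj₁ p *ℚ coeffM (over (proj₂ p)) w)

coeffF-φ : ∀ x w → coeffF (φ x) w ≡ φF x w
coeffF-φ x w = trans (coeffF-evalY (φ x) w)
  (trans (evalY-φ x (δ₁ w)) (∑-cong x (λ p → cong (proj₁ p *ℚ_) (evalY-M-δ₁ (over (proj₂ p)) w))))

evalYY-ΔY : ∀ y h → evalYY (ΔY y) h ≡ evalY y (λ w → evalYY (ΔF w) h)
evalYY-ΔY y h = trans (∑-concatMap _ y _) (∑-cong y (λ p → evalYY-scaleYY (proj₁ p) (ΔF (proj₂ p)) h))

evalYY-ΔF : ∀ w h → evalYY (ΔF w) h ≡ ∑ (upTo (suc (size w))) (λ i → h (takeTree i w) (dropTree i w))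
evalYY-ΔF w h = begin
  evalYY (ΔF w) h
    ≡⟨ cong (λ z → evalYY z h) (ΔF-split w) ⟩
  evalYY (map (λ i → (1ℚ , takeTree i w , dropTree i w)) (upTo (suc (size w)))) h
    ≡⟨ ∑-map (λ i → (1ℚ , takeTree i w , dropTree i w)) (upTo (suc (size w))) (λ p → proj₁ p *ℚ h (proj₁ (proj₂ p)) (proj₂ (proj₂ p))) ⟩
  ∑ (upTo (suc (size w))) (λ i → 1ℚ *ℚ h (takeTree i w) (dropTree i w))
    ≡⟨ ∑-cong (upTo (suc (size w))) (λ i → ℚ.*-identityˡ (h (takeTree i w) (dropTree i w))) ⟩
  ∑ (upTo (suc (size w))) (λ i → h (takeTree i w) (dropTree i w)) ∎
  where open ≡-Reasoning

evalYY-M⊗M : ∀ a b h → evalYY (M⊗M a b) h ≡ evalY (M a) (λ s → evalY (M b) (h s))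
evalYY-M⊗M a b h = trans (∑-concatMap _ (M a) _) (∑-cong (M a) λ p →
  trans (∑-map _ (M b) _)
  (trans (∑-cong (M b) (λ q → ℚ.*-assoc (proj₁ p) (proj₁ q) (h (proj₂ p) (proj₂ q))))
         (∑-*ˡ (M b) (proj₁ p) (λ q → proj₁ q *ℚ h (proj₂ p) (proj₂ q)))))

coeffFF-M⊗M : ∀ a b s u → evalYY (M⊗M a b) (δ₂ s u) ≡ coeffM a s *ℚ coeffM b u
coeffFF-M⊗M a b s u = begin
  evalYY (M⊗M a b) (δ₂ s u)
    ≡⟨ evalYY-M⊗M a b (δ₂ s u) ⟩
  evalY (M a) (λ a' → evalY (M b) (λ b' → 𝟙 ((a' ==T s) ∧ (b' ==T u))))
    ≡⟨ ∑-cong (M a) (λ p → cong (proj₁ p *ℚ_) (trans (∑-cong (M b) (λ q → cong (proj₁ q *ℚ_) (𝟙-∧ (proj₂ p ==T s) (proj₂ q ==T u))))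
                                                      (evalY-*ˡ (M b) (δ₁ s (proj₂ p)) (δ₁ u)))) ⟩
  evalY (M a) (λ a' → δ₁ s a' *ℚ evalY (M b) (δ₁ u))
    ≡⟨ evalY-*ʳ (M a) (evalY (M b) (δ₁ u)) (δ₁ s) ⟩
  evalY (M a) (δ₁ s) *ℚ evalY (M b) (δ₁ u)
    ≡⟨ cong₂ _*ℚ_ (evalY-M-δ₁ a s) (evalY-M-δ₁ b u) ⟩
  coeffM a s *ℚ coeffM b u ∎
  where open ≡-Reasoning

evalYY-φ⊗φ : ∀ z h → evalYY (φ⊗φ z) h ≡ ∑ z (λ p → proj₁ p *ℚ evalYY (M⊗M (over (proj₁ (proj₂ p))) (over (proj₂ (proj₂ p)))) h)
evalYY-φ⊗φ z h = trans (∑-concatMap _ z _) (∑-cong z (λ p → evalYY-scaleYY (proj₁ p) (M⊗M (over (proj₁ (proj₂ p))) (over (proj₂ (proj₂ p)))) h))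

-- Unitriangular transforms

module Unitriangular {E : Set} (L : List E) (In : E → Set) (allIn : All In L)
  (_==_ : E → E → Bool) (==-sound : ∀ x y → (x == y) ≡ true → x ≡ y)
  (∑-pick : ∀ s → In s → (g : E → ℚ) → ∑ L (λ x → when (x == s) (g x)) ≡ g s)
  (rk : E → ℕ) (K : E → E → ℚ) (K-refl : ∀ s → K s s ≡ 1ℚ)
  (K-zero : ∀ x s → (x == s) ≡ false → rk s ≤ rk x → K x s ≡ 0ℚ) where

  transform : (E → ℚ) → E → ℚ
  transform d s = ∑ L (λ x → d x *ℚ K x s)

  transform-split : ∀ d s → In s → transform d s ≡ d s +ℚ ∑ L (λ x → when (not (x == s)) (d x *ℚ K x s))
  transform-split d s s∈ = trans (∑-cong L diagonal)
    (trans (∑-distrib-+ L (λ x → when (x == s) (d x)) (λ x → when (not (x == s)) (d x *ℚ K x s)))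
           (cong (_+ℚ ∑ L (λ x → when (not (x == s)) (d x *ℚ K x s))) (∑-pick s s∈ d)))
    where
    diagonal : ∀ x → d x *ℚ K x s ≡ when (x == s) (d x) +ℚ when (not (x == s)) (d x *ℚ K x s)
    diagonal x with x == s in x=s
    ... | true rewrite ==-sound x s x=s = trans (trans (cong (d s *ℚ_) (K-refl s)) (ℚ.*-identityʳ (d s))) (sym (ℚ.+-identityʳ _))
    ... | false = sym (ℚ.+-identityˡ _)

  -- By induction on rk s: every other x in the transform at s either has K x s = 0 or smaller rank.
  transform-injective : ∀ d d' → (∀ s → In s → transform d s ≡ transform d' s) → ∀ s → In s → d s ≡ d' s
  transform-injective d d' same s s∈ = by-rank (suc (rk s)) s s∈ ℕ.≤-refl
    where
    by-rank : ∀ N s → In s → rk s < N → d s ≡ d' s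
    by-rank (suc N) s s∈ (s≤s rk≤N) = +-Group.∙-cancelʳ (off d) (d s) (d' s) (begin
      d s +ℚ off d          ≡⟨ transform-split d s s∈ ⟨
      transform d s         ≡⟨ same s s∈ ⟩
      transform d' s        ≡⟨ transform-split d' s s∈ ⟩
      d' s +ℚ off d'        ≡⟨ cong (d' s +ℚ_) (∑-cong-local L allIn off-diagonal) ⟨
      d' s +ℚ off d         ∎)
      where
      open ≡-Reasoning
      off : (E → ℚ) → ℚ
      off e = ∑ L (λ x → when (not (x == s)) (e x *ℚ K x s))
      off-diagonal : ∀ x → In x → when (not (x == s)) (d x *ℚ K x s) ≡ when (not (x == s)) (d' x *ℚ K x s)
      off-diagonal x x∈ with x == s in x==s
      ... | true = refl
      ... | false with ℕ.<-≤-connex (rk x) (rk s)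
      ...   | inj₁ x<s = cong (_*ℚ K x s) (by-rank N x x∈ (ℕ.<-≤-trans x<s rk≤N))
      ...   | inj₂ s≤x rewrite K-zero x s x==s s≤x = trans (ℚ.*-zeroʳ (d x)) (sym (ℚ.*-zeroʳ (d' x)))

==T-sound : ∀ s t → (s ==T t) ≡ true → s ≡ t
==T-sound s t = reflects-sound (==T-reflects s t)

coeffM-below : ∀ t s → (t ==T s) ≡ false → potential s ≤ potential t → coeffM t s ≡ 0ℚ
coeffM-below t s t≠s s≤t = coeffM-⋢ t s λ t⊑s → ℕ.<⇒≱ (⊑-potential-< t⊑s (reflects-refute (==T-reflects t s) t≠s)) s≤t

module M-Transform (n : ℕ) = Unitriangular (trees n) (λ t → size t ≡ n) (trees-sized n)
  _==T_ ==T-sound (∑-trees-pick n) potential coeffM coeffM-refl coeffM-below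

treePairs : ℕ → ℕ → List (Tree × Tree)
treePairs j m = concatMap (λ a → map (a ,_) (trees m)) (trees j)

Sized² : ℕ → ℕ → Tree × Tree → Set
Sized² j m (a , b) = size a ≡ j × size b ≡ m

_==T²_ : Tree × Tree → Tree × Tree → Bool
(a , b) ==T² (c , d) = (a ==T c) ∧ (b ==T d)

potential² : Tree × Tree → ℕ
potential² (a , b) = potential a + potential b

ζ² : Tree × Tree → Tree × Tree → ℚ
ζ² (a , b) (c , d) = 𝟙 (leqT a c ∧ leqT b d)

∑-treePairs : ∀ j m (F : Tree × Tree → ℚ) → ∑ (treePairs j m) F ≡ ∑ (trees j) (λ a → ∑ (trees m) (λ b → F (a , b)))
∑-treePairs j m F = trans (∑-concatMap _ (trees j) F) (∑-cong (trees j) (λ a → ∑-map (a ,_) (trees m) F))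

treePairs-sized : ∀ j m → All (Sized² j m) (treePairs j m)
treePairs-sized j m = All-concatMap⁺ (λ a → map (a ,_) (trees m))
  (Amap (λ sa → All.map⁺ (Amap (λ sb → sa , sb) (trees-sized m))) (trees-sized j))

==T²-sound : ∀ x y → (x ==T² y) ≡ true → x ≡ y
==T²-sound (a , b) (c , d) = reflects-sound (reflects-map (uncurry (cong₂ _,_)) (λ { refl → refl , refl })
  (==T-reflects a c ×-reflects ==T-reflects b d))

∑-treePairs-pick : ∀ j m s → Sized² j m s → (g : Tree × Tree → ℚ) → ∑ (treePairs j m) (λ x → when (x ==T² s) (g x)) ≡ g s
∑-treePairs-pick j m (s , u) (ss , su) g = begin
  ∑ (treePairs j m) (λ x → when (x ==T² (s , u)) (g x))
    ≡⟨ ∑-treePairs j m _ ⟩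
  ∑ (trees j) (λ a → ∑ (trees m) (λ b → when ((a ==T s) ∧ (b ==T u)) (g (a , b))))
    ≡⟨ ∑-cong (trees j) (λ a → trans (∑-cong (trees m) (λ b → when-∧ (a ==T s) (b ==T u) (g (a , b)))) (∑-when (a ==T s) (trees m) _)) ⟩
  ∑ (trees j) (λ a → when (a ==T s) (∑ (trees m) (λ b → when (b ==T u) (g (a , b)))))
    ≡⟨ ∑-trees-pick j s ss _ ⟩
  ∑ (trees m) (λ b → when (b ==T u) (g (s , b)))
    ≡⟨ ∑-trees-pick m u su (λ b → g (s , b)) ⟩
  g (s , u) ∎
  where open ≡-Reasoning

ζ²-refl : ∀ x → ζ² x x ≡ 1ℚ
ζ²-refl (a , b) = cong 𝟙 (cong₂ _∧_ (leqT-refl a) (leqT-refl b))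

ζ²-below : ∀ x z → (x ==T² z) ≡ false → potential² z ≤ potential² x → ζ² x z ≡ 0ℚ
ζ²-below (a , b) (c , d) x≠z z≤x with leqT a c | leqT-reflects a c | leqT b d | leqT-reflects b d
... | false | _ | _ | _ = refl
... | true | _ | false | _ = refl
... | true | ofʸ a⊑c | true | ofʸ b⊑d with a ==T c | ==T-reflects a c | b ==T d | ==T-reflects b d
...   | true | ofʸ refl | true | ofʸ refl with () ← x≠z
...   | false | ofⁿ a≢c | _ | _ =
  ⊥-elim (ℕ.<-irrefl refl (ℕ.<-≤-trans (ℕ.+-mono-<-≤ (⊑-potential-< a⊑c a≢c) (⊑-potential b⊑d)) z≤x))
...   | true | _ | false | ofⁿ b≢d =
  ⊥-elim (ℕ.<-irrefl refl (ℕ.<-≤-trans (ℕ.+-mono-≤-< (⊑-potential a⊑c) (⊑-potential-< b⊑d b≢d)) z≤x))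

module ζ²-Transform (j m : ℕ) = Unitriangular (treePairs j m) (Sized² j m) (treePairs-sized j m)
  _==T²_ ==T²-sound (∑-treePairs-pick j m) potential² ζ² ζ²-refl ζ²-below

-- The coproduct of the monomial basis

＼-assoc : ∀ a b c → (a ＼ b) ＼ c ≡ a ＼ (b ＼ c)
＼-assoc leaf b c = refl
＼-assoc (node x y) b c = cong (node x) (＼-assoc y b c)

over-++ : ∀ xs ys → over (xs ++ ys) ≡ over xs ＼ over ys
over-++ [] ys = refl
over-++ (x ∷ xs) ys = trans (cong (x ＼_) (over-++ xs ys)) (sym (＼-assoc x (over xs) (over ys)))

over-take-drop : ∀ i ts → over (take i ts) ＼ over (drop i ts) ≡ over ts
over-take-drop i ts = trans (sym (over-++ (take i ts) (drop i ts))) (cong over (List.take++drop≡id i ts))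

size-over-take-drop : ∀ i ts → size (over (take i ts)) + size (over (drop i ts)) ≡ size (over ts)
size-over-take-drop i ts = trans (sym (size-＼ (over (take i ts)) (over (drop i ts)))) (cong size (over-take-drop i ts))

-- The uniqueness of the decomposition into progressive components, in coefficient form.
∑-over-take-drop : ∀ ts → All Progressive ts → ∀ s u →
  ∑< (suc (length ts)) (λ i → 𝟙 (over (take i ts) ==T s) *ℚ 𝟙 (over (drop i ts) ==T u)) ≡ 𝟙 (over ts ==T (s ＼ u))
∑-over-take-drop [] [] leaf u = trans (ℚ.+-identityʳ (1ℚ *ℚ 𝟙 (leaf ==T u))) (ℚ.*-identityˡ (𝟙 (leaf ==T u)))
∑-over-take-drop [] [] (node _ _) u = trans (ℚ.+-identityʳ (0ℚ *ℚ 𝟙 (leaf ==T u))) (ℚ.*-zeroˡ (𝟙 (leaf ==T u)))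
∑-over-take-drop (node a leaf ∷ ts) (prog .a ∷ _) leaf u =
  trans (cong₂ _+ℚ_ (ℚ.*-identityˡ (𝟙 (over (node a leaf ∷ ts) ==T u)))
                    (∑<-zero (suc (length ts)) (λ i _ → ℚ.*-zeroˡ (𝟙 (over (drop i ts) ==T u)))))
        (ℚ.+-identityʳ (𝟙 (over (node a leaf ∷ ts) ==T u)))
∑-over-take-drop (node a leaf ∷ ts) (prog .a ∷ ps) (node s₁ s₂) u = begin
  0ℚ *ℚ 𝟙 (over (node a leaf ∷ ts) ==T u) +ℚ ∑< (suc (length ts)) (λ i → 𝟙 ((a ==T s₁) ∧ Tᵢ i) *ℚ Dᵢ i)
    ≡⟨ cong₂ _+ℚ_ (ℚ.*-zeroˡ (𝟙 (over (node a leaf ∷ ts) ==T u))) (∑<-cong (suc (length ts)) (λ i _ → 𝟙-∧-* (a ==T s₁) (Tᵢ i) (Dᵢ i))) ⟩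
  0ℚ +ℚ ∑< (suc (length ts)) (λ i → when (a ==T s₁) (𝟙 (Tᵢ i) *ℚ Dᵢ i))
    ≡⟨ ℚ.+-identityˡ _ ⟩
  ∑< (suc (length ts)) (λ i → when (a ==T s₁) (𝟙 (Tᵢ i) *ℚ Dᵢ i))
    ≡⟨ ∑<-when (a ==T s₁) (suc (length ts)) (λ i → 𝟙 (Tᵢ i) *ℚ Dᵢ i) ⟩
  when (a ==T s₁) (∑< (suc (length ts)) (λ i → 𝟙 (Tᵢ i) *ℚ Dᵢ i))
    ≡⟨ cong (when (a ==T s₁)) (∑-over-take-drop ts ps s₂ u) ⟩
  when (a ==T s₁) (𝟙 (over ts ==T (s₂ ＼ u)))
    ≡⟨ when-∧ (a ==T s₁) (over ts ==T (s₂ ＼ u)) 1ℚ ⟨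
  𝟙 ((a ==T s₁) ∧ (over ts ==T (s₂ ＼ u))) ∎
  where
  open ≡-Reasoning
  Tᵢ : ℕ → Bool
  Tᵢ i = over (take i ts) ==T s₂
  Dᵢ : ℕ → ℚ
  Dᵢ i = 𝟙 (over (drop i ts) ==T u)

coeffΔF : Tree → Tree → Tree → ℚ
coeffΔF w s u = ∑ (upTo (suc (size w))) (λ i → δ₂ s u (takeTree i w) (dropTree i w))

δ₂-zero : ∀ a b s u → ¬ (a ≡ s × b ≡ u) → δ₂ s u a b ≡ 0ℚ
δ₂-zero a b s u ≢ = cong 𝟙 (reflects-false (==T-reflects a s ×-reflects ==T-reflects b u) ≢)

coeffΔF-size : ∀ w s u → size s + size u ≢ size w → coeffΔF w s u ≡ 0ℚ
coeffΔF-size w s u ≢ = ∑-zero (upTo (suc (size w))) λ i →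
  δ₂-zero (takeTree i w) (dropTree i w) s u λ { (refl , refl) → ≢ (size-takeTree+dropTree i w) }

coeffΔF-sized : ∀ w s u → size s + size u ≡ size w → coeffΔF w s u ≡ δ₂ s u (takeTree (size s) w) (dropTree (size s) w)
coeffΔF-sized w s u su≡w = trans (∑-upTo (suc (size w)) g)
  (∑<-single (suc (size w)) (size s) (s≤s (subst (size s ≤_) su≡w (ℕ.m≤m+n _ _))) g λ i i≤w i≢s →
    δ₂-zero (takeTree i w) (dropTree i w) s u λ { (refl , _) → i≢s (sym (size-takeTree i w (ℕ.≤-pred i≤w))) })
  where
  g : ℕ → ℚ
  g i = δ₂ s u (takeTree i w) (dropTree i w)

leqT-＼-galois : ∀ w s u → (leqT (takeTree (size s) w) s ∧ leqT (dropTree (size s) w) u) ≡ leqT w (s ＼ u)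
leqT-＼-galois w s u = det
  (reflects-map (Equivalence.from (⊑-＼-galois w s u)) (Equivalence.to (⊑-＼-galois w s u))
                (leqT-reflects (takeTree (size s) w) s ×-reflects leqT-reflects (dropTree (size s) w) u))
  (leqT-reflects w (s ＼ u))

-- Only the cut of w at |z₁| contributes, and the Galois connection decides whether it lies below (z₁, z₂).
ζ²-transform-ΔF : ∀ j m w z₁ z₂ → size w ≡ j + m → size z₁ ≡ j →
  ∑ (trees j) (λ a → ∑ (trees m) (λ b → coeffΔF w a b *ℚ ζ² (a , b) (z₁ , z₂))) ≡ 𝟙 (leqT w (z₁ ＼ z₂))
ζ²-transform-ΔF j m w z₁ z₂ w≡jm refl = begin
  ∑ (trees j) (λ a → ∑ (trees m) (λ b → coeffΔF w a b *ℚ ζ² (a , b) (z₁ , z₂)))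
    ≡⟨ ∑-cong-local (trees j) (trees-sized j) (λ a sa → ∑-cong-local (trees m) (trees-sized m) (λ b sb →
         cong (_*ℚ ζ² (a , b) (z₁ , z₂)) (coeff-ab a b sa sb))) ⟩
  ∑ (trees j) (λ a → ∑ (trees m) (λ b → 𝟙 ((a ==T A) ∧ (b ==T B)) *ℚ ζ² (a , b) (z₁ , z₂)))
    ≡⟨ ∑-cong (trees j) (λ a → trans (∑-cong (trees m) (λ b → 𝟙-∧-* (a ==T A) (b ==T B) (ζ² (a , b) (z₁ , z₂))))
                                      (∑-when (a ==T A) (trees m) _)) ⟩
  ∑ (trees j) (λ a → when (a ==T A) (∑ (trees m) (λ b → 𝟙 (b ==T B) *ℚ ζ² (a , b) (z₁ , z₂))))
    ≡⟨ ∑-trees-pick j A (size-takeTree j w j≤w) _ ⟩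
  ∑ (trees m) (λ b → 𝟙 (b ==T B) *ℚ ζ² (A , b) (z₁ , z₂))
    ≡⟨ ∑-cong (trees m) (λ b → 𝟙-* (b ==T B) (ζ² (A , b) (z₁ , z₂))) ⟩
  ∑ (trees m) (λ b → when (b ==T B) (ζ² (A , b) (z₁ , z₂)))
    ≡⟨ ∑-trees-pick m B (trans (size-dropTree j w j≤w) (trans (cong (_∸ j) w≡jm) (ℕ.m+n∸m≡n j m))) _ ⟩
  𝟙 (leqT A z₁ ∧ leqT B z₂)
    ≡⟨ cong 𝟙 (leqT-＼-galois w z₁ z₂) ⟩
  𝟙 (leqT w (z₁ ＼ z₂)) ∎
  where
  open ≡-Reasoning
  j≤w : size z₁ ≤ size w
  j≤w = subst (size z₁ ≤_) (sym w≡jm) (ℕ.m≤m+n (size z₁) m)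
  A B : Tree
  A = takeTree (size z₁) w
  B = dropTree (size z₁) w
  coeff-ab : ∀ a b → size a ≡ size z₁ → size b ≡ m → coeffΔF w a b ≡ 𝟙 ((a ==T A) ∧ (b ==T B))
  coeff-ab a b sa sb = begin
    coeffΔF w a b                           ≡⟨ coeffΔF-sized w a b (trans (cong₂ _+_ sa sb) (sym w≡jm)) ⟩
    𝟙 ((takeTree (size a) w ==T a) ∧ (B' ==T b)) ≡⟨ cong (λ k → 𝟙 ((takeTree k w ==T a) ∧ (B' ==T b))) sa ⟩
    𝟙 ((A ==T a) ∧ (B' ==T b))              ≡⟨ cong 𝟙 (cong₂ _∧_ (==T-sym A a) (cong (_==T b) (cong (λ k → dropTree k w) sa))) ⟩
    𝟙 ((a ==T A) ∧ (B ==T b))               ≡⟨ cong (λ c → 𝟙 ((a ==T A) ∧ c)) (==T-sym B b) ⟩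
    𝟙 ((a ==T A) ∧ (b ==T B))               ∎
    where
    B' : Tree
    B' = dropTree (size a) w

coeffΔM : Tree → Tree × Tree → ℚ
coeffΔM t (s , u) = ∑ (trees (size t)) (λ w → coeffM t w *ℚ coeffΔF w s u)

coeffDeconc : List Tree → Tree × Tree → ℚ
coeffDeconc ts (s , u) = ∑ (upTo (suc (length ts))) (λ i → coeffM (over (take i ts)) s *ℚ coeffM (over (drop i ts)) u)

ζ²-transform-ΔM : ∀ j m t z → j + m ≡ size t → Sized² j m z →
  ζ²-Transform.transform j m (coeffΔM t) z ≡ 𝟙 (t ==T (proj₁ z ＼ proj₂ z))
ζ²-transform-ΔM j m t (z₁ , z₂) jm≡t (refl , refl) = begin
  ∑ (treePairs j m) (λ x → coeffΔM t x *ℚ ζ² x (z₁ , z₂))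
    ≡⟨ ∑-treePairs j m _ ⟩
  ∑ (trees j) (λ a → ∑ (trees m) (λ b → ∑ W (λ w → coeffM t w *ℚ coeffΔF w a b) *ℚ ζ² (a , b) (z₁ , z₂)))
    ≡⟨ ∑-cong (trees j) (λ a → ∑-cong (trees m) (λ b →
         trans (sym (∑-*ʳ W (ζ² (a , b) (z₁ , z₂)) (λ w → coeffM t w *ℚ coeffΔF w a b)))
               (∑-cong W (λ w → ℚ.*-assoc (coeffM t w) (coeffΔF w a b) (ζ² (a , b) (z₁ , z₂)))))) ⟩
  ∑ (trees j) (λ a → ∑ (trees m) (λ b → ∑ W (λ w → coeffM t w *ℚ (coeffΔF w a b *ℚ ζ² (a , b) (z₁ , z₂)))))
    ≡⟨ trans (∑-cong (trees j) (λ a → ∑-comm (trees m) W _)) (∑-comm (trees j) W _) ⟩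
  ∑ W (λ w → ∑ (trees j) (λ a → ∑ (trees m) (λ b → coeffM t w *ℚ (coeffΔF w a b *ℚ ζ² (a , b) (z₁ , z₂)))))
    ≡⟨ ∑-cong W (λ w → trans (∑-cong (trees j) (λ a → ∑-*ˡ (trees m) (coeffM t w) _)) (∑-*ˡ (trees j) (coeffM t w) _)) ⟩
  ∑ W (λ w → coeffM t w *ℚ ∑ (trees j) (λ a → ∑ (trees m) (λ b → coeffΔF w a b *ℚ ζ² (a , b) (z₁ , z₂))))
    ≡⟨ ∑-cong-local W (trees-sized (size t)) (λ w sw →
         trans (cong (coeffM t w *ℚ_) (ζ²-transform-ΔF j m w z₁ z₂ (trans sw (sym jm≡t)) refl))
               (*-𝟙 (leqT w (z₁ ＼ z₂)) (coeffM t w))) ⟩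
  ∑ W (λ w → when (leqT w (z₁ ＼ z₂)) (coeffM t w))
    ≡⟨ ∑-coeffM-below (size t) t (z₁ ＼ z₂) (trans (size-＼ z₁ z₂) jm≡t) ⟩
  𝟙 (t ==T (z₁ ＼ z₂)) ∎
  where
  open ≡-Reasoning
  W : List Tree
  W = trees (size t)

ζ²-transform-deconc : ∀ j m ts → All Progressive ts → ∀ z → Sized² j m z →
  ζ²-Transform.transform j m (coeffDeconc ts) z ≡ 𝟙 (over ts ==T (proj₁ z ＼ proj₂ z))
ζ²-transform-deconc j m ts ps (z₁ , z₂) (s₁ , s₂) = begin
  ∑ (treePairs j m) (λ x → coeffDeconc ts x *ℚ ζ² x (z₁ , z₂))
    ≡⟨ ∑-treePairs j m _ ⟩
  ∑ (trees j) (λ a → ∑ (trees m) (λ b → coeffDeconc ts (a , b) *ℚ 𝟙 (leqT a z₁ ∧ leqT b z₂)))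
    ≡⟨ ∑-cong (trees j) (λ a → ∑-cong (trees m) (λ b → cong (coeffDeconc ts (a , b) *ℚ_) (𝟙-∧ (leqT a z₁) (leqT b z₂)))) ⟩
  ∑ (trees j) (λ a → ∑ (trees m) (λ b → coeffDeconc ts (a , b) *ℚ (𝟙 (leqT a z₁) *ℚ 𝟙 (leqT b z₂))))
    ≡⟨ ∑-∑-bilinear (trees j) (trees m) (upTo (suc (length ts))) (λ i → coeffM (over (take i ts))) (λ i → coeffM (over (drop i ts)))
                     (λ a → 𝟙 (leqT a z₁)) (λ b → 𝟙 (leqT b z₂)) ⟩
  ∑ (upTo (suc (length ts))) (λ i → ∑ (trees j) (λ a → coeffM (over (take i ts)) a *ℚ 𝟙 (leqT a z₁))
                                  *ℚ ∑ (trees m) (λ b → coeffM (over (drop i ts)) b *ℚ 𝟙 (leqT b z₂)))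
    ≡⟨ ∑-cong (upTo (suc (length ts))) (λ i → cong₂ _*ℚ_ (below-ζ (over (take i ts)) z₁ s₁) (below-ζ (over (drop i ts)) z₂ s₂)) ⟩
  ∑ (upTo (suc (length ts))) (λ i → 𝟙 (over (take i ts) ==T z₁) *ℚ 𝟙 (over (drop i ts) ==T z₂))
    ≡⟨ ∑-upTo (suc (length ts)) (λ i → 𝟙 (over (take i ts) ==T z₁) *ℚ 𝟙 (over (drop i ts) ==T z₂)) ⟩
  ∑< (suc (length ts)) (λ i → 𝟙 (over (take i ts) ==T z₁) *ℚ 𝟙 (over (drop i ts) ==T z₂))
    ≡⟨ ∑-over-take-drop ts ps z₁ z₂ ⟩
  𝟙 (over ts ==T (z₁ ＼ z₂)) ∎
  where
  open ≡-Reasoning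
  below-ζ : ∀ {k} t z → size z ≡ k → ∑ (trees k) (λ a → coeffM t a *ℚ 𝟙 (leqT a z)) ≡ 𝟙 (t ==T z)
  below-ζ {k} t z sz = trans (∑-cong (trees k) (λ a → *-𝟙 (leqT a z) (coeffM t a))) (∑-coeffM-below k t z sz)

coeffΔM≡coeffDeconc : ∀ ts → All Progressive ts → ∀ x → coeffΔM (over ts) x ≡ coeffDeconc ts x
coeffΔM≡coeffDeconc ts ps (s , u) with (size s + size u) ℕ.≟ size (over ts)
... | no ≢ = trans vanishΔM (sym vanishDeconc)
  where
  vanishΔM : coeffΔM (over ts) (s , u) ≡ 0ℚ
  vanishΔM = ∑-zero-local (trees (size (over ts))) (trees-sized _) λ w sw →
    trans (cong (coeffM (over ts) w *ℚ_) (coeffΔF-size w s u (λ e → ≢ (trans e sw)))) (ℚ.*-zeroʳ (coeffM (over ts) w))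
  vanishDeconc : coeffDeconc ts (s , u) ≡ 0ℚ
  vanishDeconc = ∑-zero (upTo (suc (length ts))) λ i → case-sizes i (size (over (take i ts)) ℕ.≟ size s)
    where
    case-sizes : ∀ i → Dec (size (over (take i ts)) ≡ size s) → coeffM (over (take i ts)) s *ℚ coeffM (over (drop i ts)) u ≡ 0ℚ
    case-sizes i (no ≢ₛ) = trans (cong (_*ℚ coeffM (over (drop i ts)) u) (coeffM-size (over (take i ts)) s ≢ₛ))
                                 (ℚ.*-zeroˡ (coeffM (over (drop i ts)) u))
    case-sizes i (yes ≡ₛ) = trans (cong (coeffM (over (take i ts)) s *ℚ_) (coeffM-size (over (drop i ts)) u λ ≡ᵤ →
      ≢ (trans (cong₂ _+_ (sym ≡ₛ) (sym ≡ᵤ)) (size-over-take-drop i ts)))) (ℚ.*-zeroʳ (coeffM (over (take i ts)) s))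
... | yes su≡t = ζ²-Transform.transform-injective (size s) (size u) (coeffΔM (over ts)) (coeffDeconc ts)
  (λ z sz → trans (ζ²-transform-ΔM (size s) (size u) (over ts) z su≡t sz) (sym (ζ²-transform-deconc (size s) (size u) ts ps z sz)))
  (s , u) (refl , refl)

-- The graded coalgebra isomorphism

coeffFF-ΔY-M : ∀ t s u → coeffFF (ΔY (M t)) s u ≡ coeffΔM t (s , u)
coeffFF-ΔY-M t s u = begin
  coeffFF (ΔY (M t)) s u                                        ≡⟨ coeffFF-evalYY (ΔY (M t)) s u ⟩
  evalYY (ΔY (M t)) (δ₂ s u)                                    ≡⟨ evalYY-ΔY (M t) (δ₂ s u) ⟩
  evalY (M t) (λ w → evalYY (ΔF w) (δ₂ s u))                    ≡⟨ evalY-M t _ ⟩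
  ∑ (trees (size t)) (λ w → coeffM t w *ℚ evalYY (ΔF w) (δ₂ s u)) ≡⟨ ∑-cong (trees (size t)) (λ w → cong (coeffM t w *ℚ_) (evalYY-ΔF w (δ₂ s u))) ⟩
  coeffΔM t (s , u)                                             ∎
  where open ≡-Reasoning

coeffFF-M⊗M-deconc : ∀ ts s u →
  ∑ (upTo (suc (length ts))) (λ i → evalYY (M⊗M (over (take i ts)) (over (drop i ts))) (δ₂ s u)) ≡ coeffDeconc ts (s , u)
coeffFF-M⊗M-deconc ts s u = ∑-cong (upTo (suc (length ts))) (λ i → coeffFF-M⊗M (over (take i ts)) (over (drop i ts)) s u)

ΔM-graded : (k : ℕ) (t : Tree) → InY k t → InGrade2 k (ΔY (M t))
ΔM-graded k .(over ts) (ts , ps , refl , refl) = cuts , λ s u → begin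
  coeffFF (ΔY (M (over ts))) s u           ≡⟨ coeffFF-ΔY-M (over ts) s u ⟩
  coeffΔM (over ts) (s , u)                ≡⟨ coeffΔM≡coeffDeconc ts ps (s , u) ⟩
  coeffDeconc ts (s , u)                   ≡⟨ coeffFF-M⊗M-deconc ts s u ⟨
  ∑ (upTo (suc (length ts))) (λ i → evalYY (M⊗M (over (take i ts)) (over (drop i ts))) (δ₂ s u))
    ≡⟨ ∑-cong (upTo (suc (length ts))) (λ i → sym (trans (evalYY-scaleYY 1ℚ (M⊗M (over (take i ts)) (over (drop i ts))) (δ₂ s u))
                                                         (ℚ.*-identityˡ (evalYY (M⊗M (over (take i ts)) (over (drop i ts))) (δ₂ s u))))) ⟩
  ∑ (upTo (suc (length ts))) (λ i → evalYY (piece (cut i)) (δ₂ s u))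
    ≡⟨ trans (∑-concatMap piece cuts (term s u)) (∑-map cut (upTo (suc (length ts))) (λ q → ∑ (piece q) (term s u))) ⟨
  evalYY (concatMap piece cuts) (δ₂ s u)
    ≡⟨ coeffFF-evalYY (concatMap piece cuts) s u ⟨
  coeffFF (concatMap piece cuts) s u ∎
  where
  open ≡-Reasoning
  Cut : Set
  Cut = Σ (ℚ × Tree × Tree) λ p → Σ ℕ λ i → Σ ℕ λ j → i + j ≡ length ts × InY i (proj₁ (proj₂ p)) × InY j (proj₂ (proj₂ p))
  cut : ℕ → Cut
  cut i = (1ℚ , over (take i ts) , over (drop i ts)) , length (take i ts) , length (drop i ts)
        , trans (sym (List.length-++ (take i ts))) (cong length (List.take++drop≡id i ts))
        , (take i ts , All.take⁺ i ps , refl , refl) , (drop i ts , All.drop⁺ i ps , refl , refl)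
  cuts : List Cut
  cuts = map cut (upTo (suc (length ts)))
  piece : Cut → YYElt
  piece q = scaleYY (proj₁ (proj₁ q)) (M⊗M (proj₁ (proj₂ (proj₁ q))) (proj₂ (proj₂ (proj₁ q))))
  term : Tree → Tree → ℚ × Tree × Tree → ℚ
  term s u p = proj₁ p *ℚ δ₂ s u (proj₁ (proj₂ p)) (proj₂ (proj₂ p))

size-over-progressive : ∀ t ts → All Progressive (t ∷ ts) → size (over (t ∷ ts)) ≢ 0
size-over-progressive (node a leaf) ts (prog .a ∷ _) ()

εM-graded : (k : ℕ) (t : Tree) → InY k t → 1 ≤ k → εY (M t) ≡ 0ℚ
εM-graded (suc k) .(over (t ∷ ts)) (t ∷ ts , ps , refl , refl) _ =
  trans (coeffF-evalY (M (over (t ∷ ts))) leaf)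
        (trans (evalY-M-δ₁ (over (t ∷ ts)) leaf) (coeffM-size (over (t ∷ ts)) leaf (size-over-progressive t ts ps)))

φ-graded : (ts : List Tree) → All Progressive ts → InGrade (length ts) (φ (basisQ ts))
φ-graded ts ps = ((1ℚ , over ts) , (ts , ps , refl , refl)) ∷ [] , λ t → refl

φ-preserves-Δ : (x : QElt) → ValidQ x → ΔY (φ x) ≈YY φ⊗φ (ΔQ x)
φ-preserves-Δ x vx s u = begin
  coeffFF (ΔY (φ x)) s u
    ≡⟨ trans (coeffFF-evalYY (ΔY (φ x)) s u) (trans (evalYY-ΔY (φ x) (δ₂ s u)) (evalY-φ x (λ w → evalYY (ΔF w) (δ₂ s u)))) ⟩
  ∑ x (λ p → proj₁ p *ℚ evalY (M (over (proj₂ p))) (λ w → evalYY (ΔF w) (δ₂ s u)))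
    ≡⟨ ∑-cong-local x vx (λ p ps → cong (proj₁ p *ℚ_) (begin
         evalY (M (over (proj₂ p))) (λ w → evalYY (ΔF w) (δ₂ s u)) ≡⟨ evalYY-ΔY (M (over (proj₂ p))) (δ₂ s u) ⟨
         evalYY (ΔY (M (over (proj₂ p)))) (δ₂ s u)                ≡⟨ coeffFF-evalYY (ΔY (M (over (proj₂ p)))) s u ⟨
         coeffFF (ΔY (M (over (proj₂ p)))) s u                     ≡⟨ coeffFF-ΔY-M (over (proj₂ p)) s u ⟩
         coeffΔM (over (proj₂ p)) (s , u)                          ≡⟨ coeffΔM≡coeffDeconc (proj₂ p) ps (s , u) ⟩
         coeffDeconc (proj₂ p) (s , u)                             ∎)) ⟩
  ∑ x (λ p → proj₁ p *ℚ coeffDeconc (proj₂ p) (s , u))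
    ≡⟨ ∑-cong x (λ p → cong (proj₁ p *ℚ_) (coeffFF-M⊗M-deconc (proj₂ p) s u)) ⟨
  ∑ x (λ p → proj₁ p *ℚ ∑ (upTo (suc (length (proj₂ p)))) (λ i → M⊗Mᵢ (proj₂ p) i))
    ≡⟨ ∑-cong x (λ p → trans (sym (∑-*ˡ (upTo (suc (length (proj₂ p)))) (proj₁ p) (λ i → M⊗Mᵢ (proj₂ p) i)))
                              (sym (∑-map (λ i → (proj₁ p , take i (proj₂ p) , drop i (proj₂ p))) (upTo (suc (length (proj₂ p)))) term))) ⟩
  ∑ x (λ p → ∑ (deconcatenations p) term)
    ≡⟨ ∑-concatMap deconcatenations x term ⟨
  ∑ (ΔQ x) (λ q → proj₁ q *ℚ evalYY (M⊗M (over (proj₁ (proj₂ q))) (over (proj₂ (proj₂ q)))) (δ₂ s u))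
    ≡⟨ trans (coeffFF-evalYY (φ⊗φ (ΔQ x)) s u) (evalYY-φ⊗φ (ΔQ x) (δ₂ s u)) ⟨
  coeffFF (φ⊗φ (ΔQ x)) s u ∎
  where
  open ≡-Reasoning
  deconcatenations : ℚ × List Tree → QQElt
  deconcatenations p = map (λ i → (proj₁ p , take i (proj₂ p) , drop i (proj₂ p))) (upTo (suc (length (proj₂ p))))
  term : ℚ × List Tree × List Tree → ℚ
  term q = proj₁ q *ℚ evalYY (M⊗M (over (proj₁ (proj₂ q))) (over (proj₂ (proj₂ q)))) (δ₂ s u)
  M⊗Mᵢ : List Tree → ℕ → ℚ
  M⊗Mᵢ ts i = evalYY (M⊗M (over (take i ts)) (over (drop i ts))) (δ₂ s u)

φ-preserves-ε : (x : QElt) → ValidQ x → εY (φ x) ≡ εQ x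
φ-preserves-ε x vx = trans (coeffF-φ x leaf) (∑-cong-local x vx empty-only)
  where
  empty-only : ∀ p → All Progressive (proj₂ p) → proj₁ p *ℚ coeffM (over (proj₂ p)) leaf ≡ when (eqListTree (proj₂ p) []) (proj₁ p)
  empty-only (c , []) [] = trans (cong (c *ℚ_) (coeffM-refl leaf)) (ℚ.*-identityʳ c)
  empty-only (c , t ∷ ts) ps = trans (cong (c *ℚ_) (coeffM-size (over (t ∷ ts)) leaf (size-over-progressive t ts ps))) (ℚ.*-zeroʳ c)

Mcoord : QElt → Tree → ℚ
Mcoord x t = ∑ x (λ p → when (over (proj₂ p) ==T t) (proj₁ p))

coeffF-φ-transform : ∀ x s → coeffF (φ x) s ≡ M-Transform.transform (size s) (Mcoord x) s
coeffF-φ-transform x s = begin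
  coeffF (φ x) s
    ≡⟨ coeffF-φ x s ⟩
  ∑ x (λ p → proj₁ p *ℚ coeffM (over (proj₂ p)) s)
    ≡⟨ ∑-cong x (λ p → sym (pick p)) ⟩
  ∑ x (λ p → ∑ 𝒴 (λ t → when (over (proj₂ p) ==T t) (proj₁ p) *ℚ coeffM t s))
    ≡⟨ ∑-comm x 𝒴 (λ p t → when (over (proj₂ p) ==T t) (proj₁ p) *ℚ coeffM t s) ⟩
  ∑ 𝒴 (λ t → ∑ x (λ p → when (over (proj₂ p) ==T t) (proj₁ p) *ℚ coeffM t s))
    ≡⟨ ∑-cong 𝒴 (λ t → ∑-*ʳ x (coeffM t s) (λ p → when (over (proj₂ p) ==T t) (proj₁ p))) ⟩
  ∑ 𝒴 (λ t → Mcoord x t *ℚ coeffM t s) ∎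
  where
  open ≡-Reasoning
  𝒴 : List Tree
  𝒴 = trees (size s)
  pick : ∀ p → ∑ 𝒴 (λ t → when (over (proj₂ p) ==T t) (proj₁ p) *ℚ coeffM t s) ≡ proj₁ p *ℚ coeffM (over (proj₂ p)) s
  pick (c , ts) = trans (∑-cong 𝒴 (λ t → trans (cong (λ b → when b c *ℚ coeffM t s) (==T-sym (over ts) t)) (when-* (t ==T over ts) c (coeffM t s))))
    (∑-trees-pick-vanishing (size s) (over ts) (λ t → c *ℚ coeffM t s)
      (λ ≢s → trans (cong (c *ℚ_) (coeffM-size (over ts) s ≢s)) (ℚ.*-zeroʳ c)))

progressive? : ∀ t → Dec (Progressive t)
progressive? leaf = no λ ()
progressive? (node l leaf) = yes (prog l)
progressive? (node l (node _ _)) = no λ ()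

eqListTree-over : ∀ as bs → All Progressive as → All Progressive bs → eqListTree as bs ≡ (over as ==T over bs)
eqListTree-over [] [] _ _ = refl
eqListTree-over [] (node b leaf ∷ bs) _ (prog .b ∷ _) = refl
eqListTree-over (node a leaf ∷ as) [] (prog .a ∷ _) _ = refl
eqListTree-over (node a leaf ∷ as) (node b leaf ∷ bs) (prog .a ∷ pa) (prog .b ∷ pb) =
  cong₂ _∧_ (Bool.∧-identityʳ (a ==T b)) (eqListTree-over as bs pa pb)

eqListTree-sound : ∀ as bs → eqListTree as bs ≡ true → as ≡ bs
eqListTree-sound [] [] _ = refl
eqListTree-sound (a ∷ as) (b ∷ bs) eq with a ==T b | ==T-reflects a b
... | true | ofʸ refl = cong (a ∷_) (eqListTree-sound as bs eq)

coeffQ-Mcoord : ∀ x → ValidQ x → ∀ ts → All Progressive ts → coeffQ x ts ≡ Mcoord x (over ts)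
coeffQ-Mcoord x vx ts pts = ∑-cong-local x vx (λ p pp → cong (λ b → when b (proj₁ p)) (eqListTree-over (proj₂ p) ts pp pts))

coeffQ-nonprogressive : ∀ x → ValidQ x → ∀ ts → ¬ All Progressive ts → coeffQ x ts ≡ 0ℚ
coeffQ-nonprogressive x vx ts ¬pts = ∑-zero-local x vx vanish
  where
  vanish : ∀ p → All Progressive (proj₂ p) → when (eqListTree (proj₂ p) ts) (proj₁ p) ≡ 0ℚ
  vanish p pp with eqListTree (proj₂ p) ts in eq
  ... | true = ⊥-elim (¬pts (subst (All Progressive) (eqListTree-sound (proj₂ p) ts eq) pp))
  ... | false = refl

φ-injective : (x y : QElt) → ValidQ x → ValidQ y → φ x ≈Y φ y → x ≈Q y
φ-injective x y vx vy φx≈φy ts with all? progressive? ts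
... | no ¬pts = trans (coeffQ-nonprogressive x vx ts ¬pts) (sym (coeffQ-nonprogressive y vy ts ¬pts))
... | yes pts = begin
  coeffQ x ts          ≡⟨ coeffQ-Mcoord x vx ts pts ⟩
  Mcoord x (over ts)   ≡⟨ M-Transform.transform-injective (size (over ts)) (Mcoord x) (Mcoord y) same-transform (over ts) refl ⟩
  Mcoord y (over ts)   ≡⟨ coeffQ-Mcoord y vy ts pts ⟨
  coeffQ y ts          ∎
  where
  open ≡-Reasoning
  same-transform : ∀ s → size s ≡ size (over ts) →
    M-Transform.transform (size (over ts)) (Mcoord x) s ≡ M-Transform.transform (size (over ts)) (Mcoord y) s
  same-transform s ≡n = subst (λ n → M-Transform.transform n (Mcoord x) s ≡ M-Transform.transform n (Mcoord y) s) ≡n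
    (trans (sym (coeffF-φ-transform x s)) (trans (φx≈φy s) (coeffF-φ-transform y s)))

components : Tree → List Tree
components leaf = []
components (node l r) = node l leaf ∷ components r

over-components : ∀ t → over (components t) ≡ t
over-components leaf = refl
over-components (node l r) = cong (node l) (over-components r)

components-progressive : ∀ t → All Progressive (components t)
components-progressive leaf = []
components-progressive (node l r) = prog l ∷ components-progressive r

scaleQ : ℚ → QElt → QElt
scaleQ c = map (λ p → (c *ℚ proj₁ p , proj₂ p))

φF-scaleQ : ∀ c x w → φF (scaleQ c x) w ≡ c *ℚ φF x w
φF-scaleQ c x w = trans (∑-map _ x _) (trans (∑-cong x (λ p → ℚ.*-assoc c (proj₁ p) _)) (∑-*ˡ x c _))

strictlyAbove : Tree → Tree → Bool
strictlyAbove s s' = leqT s s' ∧ not (s ==T s')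

strictlyAbove-reflects : ∀ s s' → Reflects (s ⊑ s' × s ≢ s') (strictlyAbove s s')
strictlyAbove-reflects s s' = leqT-reflects s s' ×-reflects ¬-reflects (==T-reflects s s')

-- M_s = F_s + Σ_{s < s'} μ(s,s') F_{s'}, so F_s = M_s − Σ_{s < s'} μ(s,s') F_{s'}: recursion up the Tamari order.
preimageF : ℕ → Tree → QElt
preimageF zero s = []
preimageF (suc f) s =
  (1ℚ , components s) ∷ concatMap (λ s' → scaleQ (- mob s s') (preimageF f s')) (filterB (strictlyAbove s) (trees (size s)))

preimageF-valid : ∀ f s → ValidQ (preimageF f s)
preimageF-valid zero s = []
preimageF-valid (suc f) s = components-progressive s ∷ All-concatMap⁺ (λ s' → scaleQ (- mob s s') (preimageF f s'))
  (universal (λ s' → All.map⁺ (preimageF-valid f s')) (filterB (strictlyAbove s) (trees (size s))))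

coeffM+strictlyAbove : ∀ s w (q : ℚ) → (s ≡ w → q ≡ 1ℚ) → when (leqT s w) q +ℚ when (strictlyAbove s w) (- q) ≡ 𝟙 (s ==T w)
coeffM+strictlyAbove s w q diagonal
  with s ==T w | ==T-reflects s w | leqT s w | leqT-reflects s w | strictlyAbove s w | strictlyAbove-reflects s w
... | true  | ofʸ refl | true  | _       | false | _       = trans (ℚ.+-identityʳ q) (diagonal refl)
... | true  | ofʸ refl | false | ofⁿ s⋢s | _     | _       = ⊥-elim (s⋢s ε)
... | true  | ofʸ refl | _     | _       | true  | ofʸ (_ , s≢s) = ⊥-elim (s≢s refl)
... | false | ofⁿ _    | true  | _       | true  | _       = ℚ.+-inverseʳ q
... | false | ofⁿ s≢w  | true  | ofʸ s⊑w | false | ofⁿ ¬above = ⊥-elim (¬above (s⊑w , s≢w))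
... | false | _        | false | _       | false | _       = ℚ.+-identityʳ 0ℚ
... | false | _        | false | ofⁿ s⋢w | true  | ofʸ (s⊑w , _) = ⊥-elim (s⋢w s⊑w)

coeffM+∑-strictlyAbove : ∀ s w →
  coeffM s w +ℚ ∑ (trees (size s)) (λ s' → when (s' ==T w) (when (strictlyAbove s s') (- mob s s'))) ≡ 𝟙 (s ==T w)
coeffM+∑-strictlyAbove s w with size w ℕ.≟ size s
... | yes ≡s = trans (cong (coeffM s w +ℚ_) (∑-trees-pick (size s) w ≡s (λ s' → when (strictlyAbove s s') (- mob s s'))))
                     (coeffM+strictlyAbove s w (mob s w) λ { refl → mob-refl s })
... | no ≢s = begin
  coeffM s w +ℚ ∑ (trees (size s)) (λ s' → when (s' ==T w) (when (strictlyAbove s s') (- mob s s')))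
    ≡⟨ cong₂ _+ℚ_ (coeffM-size s w (≢s ∘ sym)) (∑-trees-pick-none (size s) w ≢s _) ⟩
  0ℚ +ℚ 0ℚ
    ≡⟨ ℚ.+-identityʳ 0ℚ ⟩
  0ℚ
    ≡⟨ cong 𝟙 (reflects-false (==T-reflects s w) (λ s≡w → ≢s (cong size (sym s≡w)))) ⟨
  𝟙 (s ==T w) ∎
  where open ≡-Reasoning

φF-preimageF : ∀ f s w → length (trees (size s)) ∸ potential s < f → φF (preimageF f s) w ≡ 𝟙 (s ==T w)
φF-preimageF (suc f) s w (s≤s fuel) = begin
  1ℚ *ℚ coeffM (over (components s)) w +ℚ φF (concatMap G (filterB (strictlyAbove s) L)) w
    ≡⟨ cong₂ _+ℚ_ (trans (ℚ.*-identityˡ _) (cong (λ t → coeffM t w) (over-components s)))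
                   (trans (∑-concatMap G (filterB (strictlyAbove s) L) _) (∑-filterB (strictlyAbove s) L _)) ⟩
  coeffM s w +ℚ ∑ L (λ s' → when (strictlyAbove s s') (φF (G s') w))
    ≡⟨ cong (coeffM s w +ℚ_) (∑-cong-local L (trees-sized (size s)) recurse) ⟩
  coeffM s w +ℚ ∑ L (λ s' → when (s' ==T w) (when (strictlyAbove s s') (- mob s s')))
    ≡⟨ coeffM+∑-strictlyAbove s w ⟩
  𝟙 (s ==T w) ∎
  where
  open ≡-Reasoning
  L : List Tree
  L = trees (size s)
  G : Tree → QElt
  G s' = scaleQ (- mob s s') (preimageF f s')
  recurse : ∀ s' → size s' ≡ size s →
    when (strictlyAbove s s') (φF (G s') w) ≡ when (s' ==T w) (when (strictlyAbove s s') (- mob s s'))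
  recurse s' ss' with strictlyAbove s s' | strictlyAbove-reflects s s'
  ... | false | _ = sym (when-0 (s' ==T w))
  ... | true | ofʸ (s⊑s' , s≢s') = begin
    φF (G s') w                         ≡⟨ φF-scaleQ (- mob s s') (preimageF f s') w ⟩
    - mob s s' *ℚ φF (preimageF f s') w ≡⟨ cong (- mob s s' *ℚ_) (φF-preimageF f s' w (ℕ.<-≤-trans gap< fuel)) ⟩
    - mob s s' *ℚ 𝟙 (s' ==T w)          ≡⟨ *-𝟙 (s' ==T w) (- mob s s') ⟩
    when (s' ==T w) (- mob s s')        ∎
    where
    gap< : length (trees (size s')) ∸ potential s' < length L ∸ potential s
    gap< = subst (λ n → length (trees n) ∸ potential s' < length L ∸ potential s) (sym ss')
             (ℕ.∸-monoʳ-< (⊑-potential-< s⊑s' s≢s') (ℕ.<⇒≤ (subst (λ n → potential s' < length (trees n)) ss' (potential<∣trees∣ s'))))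

preimage : Tree → QElt
preimage s = preimageF (suc (length (trees (size s)))) s

φF-preimage : ∀ s w → φF (preimage s) w ≡ 𝟙 (s ==T w)
φF-preimage s w = φF-preimageF (suc (length (trees (size s)))) s w (s≤s (ℕ.m∸n≤m _ (potential s)))

φ-surjective : (y : YElt) → Σ QElt λ x → ValidQ x × φ x ≈Y y
φ-surjective y = concatMap scaledPreimage y , All-concatMap⁺ scaledPreimage (universal (λ p → All.map⁺ (preimageF-valid _ (proj₂ p))) y) , λ w → begin
  coeffF (φ (concatMap scaledPreimage y)) w
    ≡⟨ trans (coeffF-φ (concatMap scaledPreimage y) w) (∑-concatMap scaledPreimage y (λ p → proj₁ p *ℚ coeffM (over (proj₂ p)) w)) ⟩
  ∑ y (λ p → φF (scaledPreimage p) w)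
    ≡⟨ ∑-cong y (λ p → trans (φF-scaleQ (proj₁ p) (preimage (proj₂ p)) w) (cong (proj₁ p *ℚ_) (φF-preimage (proj₂ p) w))) ⟩
  ∑ y (λ p → proj₁ p *ℚ 𝟙 (proj₂ p ==T w))
    ≡⟨ ∑-cong y (λ p → *-𝟙 (proj₂ p ==T w) (proj₁ p)) ⟩
  coeffF y w ∎
  where
  open ≡-Reasoning
  scaledPreimage : ℚ × Tree → QElt
  scaledPreimage p = scaleQ (proj₁ p) (preimage (proj₂ p))

theorem5p2 :
    -- (1) coalgebra grading
    ((k : ℕ) (t : Tree) → InY k t → InGrade2 k (ΔY (M t)))
    × ((k : ℕ) (t : Tree) → InY k t → 1 ≤ k → εY (M t) ≡ 0ℚ)
    -- (2) φ : Q((𝒴Sym)^1) → 𝒴Sym is a linear bijection ...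
    × ((x y : QElt) → ValidQ x → ValidQ y → φ x ≈Y φ y → x ≈Q y)
    × ((y : YElt) → Σ QElt λ x → ValidQ x × φ x ≈Y y)
    -- ... preserving the grading ...
    × ((ts : List Tree) → All Progressive ts → InGrade (length ts) (φ (basisQ ts)))
    -- ... and a coalgebra morphism
    × ((x : QElt) → ValidQ x → ΔY (φ x) ≈YY φ⊗φ (ΔQ x))
    × ((x : QElt) → ValidQ x → εY (φ x) ≡ εQ x)
theorem5p2 = ΔM-graded , εM-graded , φ-injective , φ-surjective , φ-graded , φ-preserves-Δ , φ-preserves-ε
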